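{- Let $n\in\mathbb{N}$ and fix $\mathbf{y}=(y_1,\ldots,y_n)\in\mathbb{N}^n$. Then \[|\mathsf{PA}_n(\mathbf{y})|=\sum_{\sigma\in\mathfrak{S}_n}|\mathcal{O}_{\mathsf{PA}_n(\mathbf{y})}^{ -1}(\sigma)|=\sum_{\sigma\in\mathfrak{S}_n}\prod_{i=1}^n P_\sigma(i),\] where for $\sigma=\sigma_1\cdots\sigma_n$ and $i\in[n]$: $P_\sigma(i)=1$ if $i=1$ or $\sigma_{i-1}>\sigma_i$; otherwise, if $\sigma_j<\sigma_i$ for all $j<i$, $P_\sigma(i)=1+\sum_{k=1}^{i-1}y_{\sigma_k}$; otherwise, with the block decomposition of $\sigma_1\cdots\sigma_{i-1}$ described below and $m(i)=\min\{1\le j\le\ell:\sum_{\sigma_k\in\alpha_j}y_{\sigma_k}\ge y_{\sigma_i}\}$, $P_\sigma(i)=1+\sum_{k=1}^{i-1}y_{\sigma_k}$ if $m(i)$ does not exist and $P_\sigma(i)=y_{\sigma_i}+\sum_{j=1}^{m(i)}\sum_{\sigma_k\in\beta_j}y_{\sigma_k}+\sum_{j=1}^{m(i)-1}\sum_{\sigma_k\in\alpha_j}y_{\sigma_k}$ if $m(i)$ exists.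
   Context: Parking assortments: $n$ cars $1,\ldots,n$ with lengths $y_1,\ldots,y_n$ park on $m=\sum_i y_i$ spots $1,\ldots,m$ of a one-way street, entering in order $1,\ldots,n$, with preference list $\mathbf{x}\in[m]^n$. Car $i$ parks in spots $x_i,\ldots,x_i+y_i-1$ if unoccupied; otherwise it proceeds and parks in the first (leftmost) block of $y_i$ contiguous unoccupied spots after $x_i$; if none exists parking fails. $\mathsf{PA}_n(\mathbf{y})$ is the set of preference lists for which all cars park. The outcome $\mathcal{O}_{\mathsf{PA}_n(\mathbf{y})}(\mathbf{x})=\sigma\in\mathfrak{S}_n$ has $\sigma_j=i$ iff car $i$ is the $j$th car from the left on the street; $\mathcal{O}_{\mathsf{PA}_n(\mathbf{y})}^{ -1}(\sigma)$ is the set of parking assortments with outcome $\sigma$. Block decomposition (used when $\sigma_{i-1}<\sigma_i$): the word $\sigma_1\cdots\sigma_{i-1}$ is split, reading from the right, into maximal contiguous blocks alternately of entries $<\sigma_i$ and entries $>\sigma_i$: $\beta_1$ (entries $<\sigma_i$, ending at position $i-1$), then $\alpha_1$ (entries $>\sigma_i$), then $\beta_2$, $\alpha_2$, …, until position 1 is reached; $\ell$ is the number of $\alpha$-blocks, and blocks are identified with the sets of car labels they contain. -}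

module Defs where

open import Data.Bool using (Bool; true; false; if_then_else_; _∧_; not)
open import Data.Nat using (ℕ; zero; suc; _+_; _*_; _≤ᵇ_; _<ᵇ_; _≡ᵇ_)
open import Data.Fin using (Fin; toℕ)
open import Data.Maybe using (Maybe; just; nothing)
import Data.Maybe as Maybe
open import Data.Product using (_×_; _,_)
open import Data.List using (List; []; _∷_; [_]; length; filterᵇ; allFin;
  concatMap; take; reverse)
open import Data.Nat.ListAction using (sum; product)
open import Data.Bool.ListAction using (all; any)
import Data.List as List
open import Data.Vec using (Vec; []; _∷_; lookup; toList)
import Data.Vec as Vec

-- Conventions: cars are labelled 0,…,n-1 (car i of the paper is Fin (i-1)),
-- lengths are a vector y : Vec ℕ n, spots are 0,…,m-1 (spot s of the
-- paper is s-1), m = sum of the lengths.  A preference list is a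
-- vector x : Vec (Fin m) n.

street : ∀ {n} → Vec ℕ n → ℕ
street y = Vec.sum y

allVecs : (k n : ℕ) → List (Vec (Fin k) n)
allVecs k zero    = [ [] ]
allVecs k (suc n) = concatMap (λ a → List.map (a ∷_) (allVecs k n)) (allFin k)

-- The parking process.  The occupied part of the street is a list of
-- intervals (start , length): spots start, …, start+length-1.

Occ : Set
Occ = List (ℕ × ℕ)

occupied : Occ → ℕ → Bool
occupied occ s = any (λ { (p , L) → (p ≤ᵇ s) ∧ (s <ᵇ p + L) }) occ

blockFree : Occ → ℕ → ℕ → Bool
blockFree occ p zero    = true
blockFree occ p (suc L) = not (occupied occ p) ∧ blockFree occ (suc p) L

firstFit : (m : ℕ) → Occ → (L : ℕ) → (p : ℕ) → (fuel : ℕ) → Maybe ℕ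
firstFit m occ L p zero = nothing
firstFit m occ L p (suc fuel) =
  if (p + L ≤ᵇ m) ∧ blockFree occ p L
  then just p
  else firstFit m occ L (suc p) fuel

parkFrom : (m : ℕ) → Occ → ∀ {k} → Vec ℕ k → Vec ℕ k → Maybe (Vec ℕ k)
parkFrom m occ []       []       = just []
parkFrom m occ (x ∷ xs) (L ∷ Ls) with firstFit m occ L x (suc m)
... | nothing = nothing
... | just p  = Maybe.map (p ∷_) (parkFrom m ((p , L) ∷ occ) xs Ls)

park : ∀ {n} (y : Vec ℕ n) → Vec (Fin (street y)) n → Maybe (Vec ℕ n)
park y x = parkFrom (street y) [] (Vec.map toℕ x) y

isPA : ∀ {n} (y : Vec ℕ n) → Vec (Fin (street y)) n → Bool
isPA y x with park y x
... | just _  = true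
... | nothing = false

PA : ∀ {n} (y : Vec ℕ n) → List (Vec (Fin (street y)) n)
PA {n} y = filterᵇ (isPA y) (allVecs (street y) n)

distinct : ∀ {n} → List (Fin n) → Bool
distinct []       = true
distinct (a ∷ as) = not (any (λ b → toℕ a ≡ᵇ toℕ b) as) ∧ distinct as

perms : (n : ℕ) → List (Vec (Fin n) n)
perms n = filterᵇ (λ σ → distinct (toList σ)) (allVecs n n)

strictlyIncreasing : List ℕ → Bool
strictlyIncreasing []           = true
strictlyIncreasing (a ∷ [])     = true
strictlyIncreasing (a ∷ b ∷ as) = (a <ᵇ b) ∧ strictlyIncreasing (b ∷ as)

-- O(x) = σ : all cars park and the cars σ₁, σ₂, …, σₙ appear in this
-- order from left to right (i.e. σ_j is the j-th car from the left)
hasOutcome : ∀ {n} (y : Vec ℕ n) → Vec (Fin n) n → Vec (Fin (street y)) n → Bool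
hasOutcome y σ x with park y x
... | just s  = strictlyIncreasing (List.map (lookup s) (toList σ))
... | nothing = false

outcomeFibre : ∀ {n} (y : Vec ℕ n) → Vec (Fin n) n → List (Vec (Fin (street y)) n)
outcomeFibre {n} y σ = filterᵇ (hasOutcome y σ) (allVecs (street y) n)

spanᵇ : ∀ {A : Set} → (A → Bool) → List A → List A × List A
spanᵇ p []       = [] , []
spanᵇ p (a ∷ as) with p a
... | false = [] , a ∷ as
... | true  with spanᵇ p as
...   | (r , s) = a ∷ r , s

-- Given c = σᵢ and the REVERSED word σ_{i-1} ⋯ σ₁, the list of pairs
-- (β₁ , α₁) , … , (β_ℓ , α_ℓ) (a possible final β-block not followed by
-- an α-block is dropped; it never enters the formula).
blocksAux : ∀ {n} → ℕ → Fin n → List (Fin n) → List (List (Fin n) × List (Fin n))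
blocksAux zero       c w = []
blocksAux (suc fuel) c w with spanᵇ (λ a → toℕ a <ᵇ toℕ c) w
... | (β , w′) with spanᵇ (λ a → toℕ c <ᵇ toℕ a) w′
...   | ([] , w″) = []
...   | (α , w″)  = (β , α) ∷ blocksAux fuel c w″

blocks : ∀ {n} → Fin n → List (Fin n) → List (List (Fin n) × List (Fin n))
blocks c w = blocksAux (length w) c w

wt : ∀ {n} → Vec ℕ n → List (Fin n) → ℕ
wt y cs = sum (List.map (lookup y) cs)

-- search for m(i): returns Σ_{j≤m} |β_j| + Σ_{j<m} |α_j| (weights) if
-- m(i) = min{ j : |α_j| ≥ y_{σᵢ} } exists
mSum : ∀ {n} → Vec ℕ n → ℕ → List (List (Fin n) × List (Fin n)) → Maybe ℕ
mSum y t []              = nothing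
mSum y t ((β , α) ∷ bs) =
  if t ≤ᵇ wt y α
  then just (wt y β)
  else Maybe.map (λ r → wt y β + wt y α + r) (mSum y t bs)

-- P_σ(i) (i is 0-based: position i+1 of the paper)
Pσ : ∀ {n} → Vec ℕ n → Vec (Fin n) n → Fin n → ℕ
Pσ y σ i with reverse (take (toℕ i) (toList σ))
... | []         = 1
... | (p ∷ rest) =
  if toℕ c <ᵇ toℕ p then 1
  else if all (λ a → toℕ a <ᵇ toℕ c) (p ∷ rest)
       then 1 + wt y (p ∷ rest)
       else (case-m (mSum y (lookup y c) (blocks c (p ∷ rest))))
  where
    c = lookup σ i
    case-m : Maybe ℕ → ℕ
    case-m nothing  = 1 + wt y (p ∷ rest)
    case-m (just s) = lookup y c + s

prodP : ∀ {n} → Vec ℕ n → Vec (Fin n) n → ℕ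
prodP {n} y σ = product (List.map (Pσ y σ) (allFin n))

module Submission where

-- Successful parking with positions s has a unique outcome σ (sort the cars by s), so
-- PA_n(y) splits into the fibres O⁻¹(σ). Since the street has exactly Σ yᵢ spots, the
-- positions are forced within a fibre: the cars are packed from the left in the order σ.
-- Hence x lies in the fibre iff each car, arriving after the earlier cars occupy their
-- forced blocks, lands on its own forced block. This is a condition on its preference
-- alone, so the fibre is a product. The admissible preferences of car σᵢ are its forced
-- spot and the spots to its left from which it slides into it; reading the occupancy
-- leftwards, they are governed by the alternating blocks β₁, α₁, β₂, … of occupied
-- (earlier) and still free (later) cars, which yields P_σ(i).

open import Data.Bool using (Bool; true; false; if_then_else_; _∧_; _∨_; not; T)
open import Data.Bool.Properties using (∨-assoc; ∨-comm; ∨-identityʳ; ∧-identityʳ; ∧-zeroʳ)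
open import Data.Bool.ListAction using (any; all; or)
open import Data.Empty using (⊥; ⊥-elim)
open import Data.Fin using (Fin; toℕ) renaming (zero to fzero; suc to fsuc)
open import Data.Fin.Properties using (toℕ-injective; toℕ<n) renaming (_≟_ to _≟ᶠ_)
open import Data.List using (List; []; _∷_; [_]; _++_; length; map; filterᵇ; allFin; tabulate;
  concatMap; replicate; reverse; take; drop)
open import Data.List.Properties using (map-tabulate; map-cong; map-∘; map-++; length-++; ++-assoc;
  ++-identityʳ; unfold-reverse; length-tabulate; ∷-injectiveˡ; ∷-injectiveʳ)
open import Data.List.Membership.Propositional using (_∈_; _∉_)
open import Data.List.Membership.Propositional.Properties using (∈-++⁺ˡ; ∈-++⁺ʳ; ∈-++⁻; ∈-∃++;
  ∈-allFin; ∈-insert)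
open import Data.List.Membership.Propositional.Properties.WithK using (unique∧set⇒bag)
open import Data.List.Relation.Binary.BagAndSetEquality using (∼bag⇒↭)
open import Data.List.Relation.Binary.Permutation.Propositional using (_↭_; prep; swap; ↭-sym; ↭-trans)
  renaming (refl to ↭-refl; trans to ↭-trans′)
open import Data.List.Relation.Binary.Permutation.Propositional.Properties using (∈-resp-↭; ↭-reverse; map⁺)
open import Data.List.Relation.Unary.All using (All; []; _∷_)
import Data.List.Relation.Unary.All as All
open import Data.List.Relation.Unary.Any using (here; there)
open import Data.List.Relation.Unary.AllPairs using (AllPairs; []; _∷_)
import Data.List.Relation.Unary.AllPairs as AllPairs
open import Data.List.Relation.Unary.All.Properties using (¬Any⇒All¬)
open import Data.List.Relation.Unary.Unique.Propositional using (Unique)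
open import Data.List.Relation.Unary.Unique.Propositional.Properties using (allFin⁺)
open import Data.Maybe using (Maybe; just; nothing)
import Data.Maybe as Maybe
open import Data.Maybe.Properties using (just-injective)
open import Data.Nat using (ℕ; zero; suc; _+_; _*_; _∸_; _≤_; _<_; z≤n; s≤s; z<s; _≤ᵇ_; _<ᵇ_; _≡ᵇ_; _≤?_)
open import Data.Nat.Properties
open import Data.Nat.ListAction using (sum; product)
open import Data.Nat.ListAction.Properties using (sum-++; sum-↭; product-↭)
open import Data.Nat.Tactic.RingSolver using (solve-∀)
open import Data.Product using (_×_; _,_; proj₁; proj₂)
open import Data.Sum using (inj₁; inj₂)
open import Data.Unit using (⊤; tt)
open import Data.Vec using (Vec; []; _∷_; toList; lookup)
import Data.Vec as Vec
import Data.Vec.Properties as Vec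
open import Function using (_∘_)
open import Function.Bundles using (mk⇔)
open import Relation.Binary.Definitions using (tri<; tri≈; tri>)
open import Relation.Binary.PropositionalEquality hiding ([_])
open import Relation.Nullary using (yes; no)

open import Defs

T⇒≡true : ∀ {b} → T b → b ≡ true
T⇒≡true {true} _ = refl

≡true⇒T : ∀ {b} → b ≡ true → T b
≡true⇒T refl = tt

∧≡true⇒ : ∀ {a b} → a ∧ b ≡ true → a ≡ true × b ≡ true
∧≡true⇒ {true} {true} _ = refl , refl

∨≡false⇒ : ∀ {a b} → a ∨ b ≡ false → a ≡ false × b ≡ false
∨≡false⇒ {false} {false} _ = refl , refl

≡true-ext : ∀ {a b : Bool} → (a ≡ true → b ≡ true) → (b ≡ true → a ≡ true) → a ≡ b
≡true-ext {false} {false} _ _ = refl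
≡true-ext {false} {true}  _ g = g refl
≡true-ext {true}  {b}     f _ = sym (f refl)

≡ᵇ-refl : ∀ n → (n ≡ᵇ n) ≡ true
≡ᵇ-refl zero    = refl
≡ᵇ-refl (suc n) = ≡ᵇ-refl n

≢⇒≡ᵇ≡false : ∀ m n → m ≢ n → (m ≡ᵇ n) ≡ false
≢⇒≡ᵇ≡false m n m≢n with m ≡ᵇ n in eq
... | false = refl
... | true  = ⊥-elim (m≢n (≡ᵇ⇒≡ m n (≡true⇒T eq)))

<ᵇ-irrefl : ∀ n → (n <ᵇ n) ≡ false
<ᵇ-irrefl zero    = refl
<ᵇ-irrefl (suc n) = <ᵇ-irrefl n

<ᵇ-asym : ∀ m n → (m <ᵇ n) ≡ true → (n <ᵇ m) ≡ false
<ᵇ-asym m n m<n with n <ᵇ m in n<m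
... | false = refl
... | true  = ⊥-elim (<-asym (<ᵇ⇒< m n (≡true⇒T m<n)) (<ᵇ⇒< n m (≡true⇒T n<m)))

≮ᵇ∧≯ᵇ⇒≡ : ∀ m n → (m <ᵇ n) ≡ false → (n <ᵇ m) ≡ false → m ≡ n
≮ᵇ∧≯ᵇ⇒≡ m n m≮n n≮m with <-cmp m n
... | tri< m<n _ _ with () ← trans (sym (T⇒≡true (<⇒<ᵇ m<n))) m≮n
... | tri≈ _ m≡n _ = m≡n
... | tri> _ _ n<m with () ← trans (sym (T⇒≡true (<⇒<ᵇ n<m))) n≮m

any-∈ : ∀ {A : Set} (f : A → Bool) {xs x} → x ∈ xs → f x ≡ true → any f xs ≡ true
any-∈ f {y ∷ xs} (here refl) fx rewrite fx = refl
any-∈ f {y ∷ xs} (there x∈xs) fx with f y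
... | true  = refl
... | false = any-∈ f x∈xs fx

any-none : ∀ {A : Set} (f : A → Bool) xs → (∀ x → x ∈ xs → f x ≡ false) → any f xs ≡ false
any-none f []       _ = refl
any-none f (y ∷ xs) h rewrite h y (here refl) = any-none f xs (λ x m → h x (there m))

any-++ : ∀ {A : Set} (f : A → Bool) xs ys → any f (xs ++ ys) ≡ any f xs ∨ any f ys
any-++ f []       ys = refl
any-++ f (x ∷ xs) ys = trans (cong (f x ∨_) (any-++ f xs ys)) (sym (∨-assoc (f x) _ _))

any-↭ : ∀ {A : Set} (f : A → Bool) {xs ys} → xs ↭ ys → any f xs ≡ any f ys
any-↭ f ↭-refl         = refl
any-↭ f (prep x p)     = cong (f x ∨_) (any-↭ f p)
any-↭ f (swap x y p)   = trans (sym (∨-assoc (f x) (f y) _))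
  (trans (cong₂ _∨_ (∨-comm (f x) (f y)) (any-↭ f p)) (∨-assoc (f y) (f x) _))
any-↭ f (↭-trans′ p q) = trans (any-↭ f p) (any-↭ f q)

any-cong : ∀ {A : Set} {f g : A → Bool} xs → (∀ x → x ∈ xs → f x ≡ g x) → any f xs ≡ any g xs
any-cong []       _ = refl
any-cong (x ∷ xs) h = cong₂ _∨_ (h x (here refl)) (any-cong xs (λ z m → h z (there m)))

any-tabulate : ∀ {A : Set} {k} (g : A → Bool) (h : Fin k → A) →
  any g (tabulate h) ≡ any (g ∘ h) (allFin k)
any-tabulate {k = k} g h =
  trans (cong or (map-tabulate h g)) (sym (cong or (map-tabulate {n = k} (λ i → i) (g ∘ h))))

all⇒All : ∀ {A : Set} (f : A → Bool) xs → all f xs ≡ true → All (λ x → f x ≡ true) xs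
all⇒All f []       _ = []
all⇒All f (x ∷ xs) e = proj₁ (∧≡true⇒ {f x} e) ∷ all⇒All f xs (proj₂ (∧≡true⇒ {f x} e))

indicator : Bool → ℕ
indicator true  = 1
indicator false = 0

countᵇ : ∀ {A : Set} → (A → Bool) → List A → ℕ
countᵇ p xs = length (filterᵇ p xs)

countᵇ-∷ : ∀ {A : Set} (p : A → Bool) x xs → countᵇ p (x ∷ xs) ≡ indicator (p x) + countᵇ p xs
countᵇ-∷ p x xs with p x
... | true  = refl
... | false = refl

countᵇ-++ : ∀ {A : Set} (p : A → Bool) xs ys → countᵇ p (xs ++ ys) ≡ countᵇ p xs + countᵇ p ys
countᵇ-++ p []       ys = refl
countᵇ-++ p (x ∷ xs) ys = begin
  countᵇ p (x ∷ xs ++ ys)                         ≡⟨ countᵇ-∷ p x (xs ++ ys) ⟩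
  indicator (p x) + countᵇ p (xs ++ ys)           ≡⟨ cong (indicator (p x) +_) (countᵇ-++ p xs ys) ⟩
  indicator (p x) + (countᵇ p xs + countᵇ p ys)   ≡⟨ sym (+-assoc (indicator (p x)) _ _) ⟩
  indicator (p x) + countᵇ p xs + countᵇ p ys     ≡⟨ cong (_+ countᵇ p ys) (sym (countᵇ-∷ p x xs)) ⟩
  countᵇ p (x ∷ xs) + countᵇ p ys                 ∎
  where open ≡-Reasoning

countᵇ-cong : ∀ {A : Set} {p q : A → Bool} → (∀ x → p x ≡ q x) → ∀ xs → countᵇ p xs ≡ countᵇ q xs
countᵇ-cong eq []       = refl
countᵇ-cong {p = p} {q} eq (x ∷ xs) = begin
  countᵇ p (x ∷ xs)                ≡⟨ countᵇ-∷ p x xs ⟩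
  indicator (p x) + countᵇ p xs    ≡⟨ cong₂ (λ b c → indicator b + c) (eq x) (countᵇ-cong eq xs) ⟩
  indicator (q x) + countᵇ q xs    ≡⟨ countᵇ-∷ q x xs ⟨
  countᵇ q (x ∷ xs)                ∎
  where open ≡-Reasoning

countᵇ-map : ∀ {A B : Set} (p : B → Bool) (f : A → B) xs → countᵇ p (map f xs) ≡ countᵇ (p ∘ f) xs
countᵇ-map p f []       = refl
countᵇ-map p f (x ∷ xs) = trans (countᵇ-∷ p (f x) (map f xs))
  (trans (cong (indicator (p (f x)) +_) (countᵇ-map p f xs)) (sym (countᵇ-∷ (p ∘ f) x xs)))

countᵇ≡sum : ∀ {A : Set} (p : A → Bool) xs → countᵇ p xs ≡ sum (map (indicator ∘ p) xs)
countᵇ≡sum p []       = refl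
countᵇ≡sum p (x ∷ xs) = trans (countᵇ-∷ p x xs) (cong (indicator (p x) +_) (countᵇ≡sum p xs))

countᵇ-none : ∀ {A : Set} (p : A → Bool) xs → (∀ x → p x ≡ false) → countᵇ p xs ≡ 0
countᵇ-none p []       _ = refl
countᵇ-none p (x ∷ xs) h = trans (countᵇ-∷ p x xs) (cong₂ _+_ (cong indicator (h x)) (countᵇ-none p xs h))

countᵇ-filterᵇ : ∀ {A : Set} (p q : A → Bool) xs → countᵇ p (filterᵇ q xs) ≡ countᵇ (λ x → q x ∧ p x) xs
countᵇ-filterᵇ p q []       = refl
countᵇ-filterᵇ p q (x ∷ xs) with q x
... | false = countᵇ-filterᵇ p q xs
... | true with p x
...   | true  = cong suc (countᵇ-filterᵇ p q xs)
...   | false = countᵇ-filterᵇ p q xs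

countᵇ-concatMap : ∀ {A B : Set} (p : B → Bool) (g : A → List B) xs →
  countᵇ p (concatMap g xs) ≡ sum (map (λ a → countᵇ p (g a)) xs)
countᵇ-concatMap p g []       = refl
countᵇ-concatMap p g (x ∷ xs) =
  trans (countᵇ-++ p (g x) (concatMap g xs)) (cong (countᵇ p (g x) +_) (countᵇ-concatMap p g xs))

countᵇ-const-∧ : ∀ {A : Set} (b : Bool) (q : A → Bool) xs → countᵇ (λ x → b ∧ q x) xs ≡ indicator b * countᵇ q xs
countᵇ-const-∧ true  q xs       = sym (+-identityʳ _)
countᵇ-const-∧ false q []       = refl
countᵇ-const-∧ false q (x ∷ xs) = countᵇ-const-∧ false q xs

∈-filterᵇ⁻ : ∀ {A : Set} (p : A → Bool) xs {x} → x ∈ filterᵇ p xs → p x ≡ true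
∈-filterᵇ⁻ p (z ∷ xs) m with p z in pz
∈-filterᵇ⁻ p (z ∷ xs) m          | false = ∈-filterᵇ⁻ p xs m
∈-filterᵇ⁻ p (z ∷ xs) (here refl) | true  = pz
∈-filterᵇ⁻ p (z ∷ xs) (there m)  | true  = ∈-filterᵇ⁻ p xs m

sum-map-+ : ∀ {A : Set} (f g : A → ℕ) xs → sum (map (λ x → f x + g x) xs) ≡ sum (map f xs) + sum (map g xs)
sum-map-+ f g []       = refl
sum-map-+ f g (x ∷ xs) rewrite sum-map-+ f g xs = solve (f x) (g x) (sum (map f xs)) (sum (map g xs))
  where
  solve : ∀ a b c d → a + b + (c + d) ≡ a + c + (b + d)
  solve = solve-∀

sum-map-*ʳ : ∀ {A : Set} (f : A → ℕ) c xs → sum (map (λ x → f x * c) xs) ≡ sum (map f xs) * c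
sum-map-*ʳ f c []       = refl
sum-map-*ʳ f c (x ∷ xs) rewrite sum-map-*ʳ f c xs = sym (*-distribʳ-+ c (f x) (sum (map f xs)))

sum-map-cong : ∀ {A : Set} {f g : A → ℕ} xs → (∀ x → x ∈ xs → f x ≡ g x) → sum (map f xs) ≡ sum (map g xs)
sum-map-cong []       _ = refl
sum-map-cong (x ∷ xs) h = cong₂ _+_ (h x (here refl)) (sum-map-cong xs (λ z m → h z (there m)))

sum-map-0 : ∀ {A : Set} (xs : List A) → sum (map (λ _ → 0) xs) ≡ 0
sum-map-0 []       = refl
sum-map-0 (x ∷ xs) = sum-map-0 xs

sum-countᵇ-swap : ∀ {A B : Set} (h : B → A → Bool) (bs : List B) (as : List A) →
  sum (map (λ b → countᵇ (h b) as) bs) ≡ sum (map (λ a → countᵇ (λ b → h b a) bs) as)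
sum-countᵇ-swap h bs []       = sum-map-0 bs
sum-countᵇ-swap h bs (a ∷ as) = begin
  sum (map (λ b → countᵇ (h b) (a ∷ as)) bs)
    ≡⟨ sum-map-cong bs (λ b _ → countᵇ-∷ (h b) a as) ⟩
  sum (map (λ b → indicator (h b a) + countᵇ (h b) as) bs)
    ≡⟨ sum-map-+ (λ b → indicator (h b a)) (λ b → countᵇ (h b) as) bs ⟩
  sum (map (λ b → indicator (h b a)) bs) + sum (map (λ b → countᵇ (h b) as) bs)
    ≡⟨ cong₂ _+_ (sym (countᵇ≡sum (λ b → h b a) bs)) (sum-countᵇ-swap h bs as) ⟩
  countᵇ (λ b → h b a) bs + sum (map (λ a → countᵇ (λ b → h b a) bs) as) ∎
  where open ≡-Reasoning

pointwiseᵇ : ∀ {k} → Vec (ℕ → Bool) k → Vec ℕ k → Bool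
pointwiseᵇ []       []       = true
pointwiseᵇ (f ∷ fs) (a ∷ as) = f a ∧ pointwiseᵇ fs as

countBelow : (ℕ → Bool) → ℕ → ℕ
countBelow f K = countᵇ (f ∘ toℕ) (allFin K)

countᵇ-allVecs-pointwise : ∀ K {k} (ps : Vec (ℕ → Bool) k) →
  countᵇ (pointwiseᵇ ps ∘ Vec.map toℕ) (allVecs K k) ≡ product (toList (Vec.map (λ f → countBelow f K) ps))
countᵇ-allVecs-pointwise K []                 = refl
countᵇ-allVecs-pointwise K {suc k} (f ∷ ps) = begin
  countᵇ P (concatMap (λ a → map (a ∷_) (allVecs K k)) (allFin K))
    ≡⟨ countᵇ-concatMap P (λ a → map (a ∷_) (allVecs K k)) (allFin K) ⟩
  sum (map (λ a → countᵇ P (map (a ∷_) (allVecs K k))) (allFin K))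
    ≡⟨ sum-map-cong (allFin K) (λ a _ → trans (countᵇ-map P (a ∷_) (allVecs K k))
                                              (countᵇ-const-∧ (f (toℕ a)) Q (allVecs K k))) ⟩
  sum (map (λ a → indicator (f (toℕ a)) * countᵇ Q (allVecs K k)) (allFin K))
    ≡⟨ sum-map-*ʳ (indicator ∘ f ∘ toℕ) _ (allFin K) ⟩
  sum (map (indicator ∘ f ∘ toℕ) (allFin K)) * countᵇ Q (allVecs K k)
    ≡⟨ cong₂ _*_ (sym (countᵇ≡sum (f ∘ toℕ) (allFin K))) (countᵇ-allVecs-pointwise K ps) ⟩
  countBelow f K * product (toList (Vec.map (λ f → countBelow f K) ps)) ∎
  where
  open ≡-Reasoning
  P : Vec (Fin K) (suc k) → Bool
  P = pointwiseᵇ (f ∷ ps) ∘ Vec.map toℕ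
  Q : Vec (Fin K) k → Bool
  Q = pointwiseᵇ ps ∘ Vec.map toℕ

sumBelow : (ℕ → ℕ) → ℕ → ℕ
sumBelow h zero    = 0
sumBelow h (suc k) = h 0 + sumBelow (h ∘ suc) k

sumBelow-suc : ∀ h k → sumBelow h (suc k) ≡ sumBelow h k + h k
sumBelow-suc h zero    = +-comm (h 0) 0
sumBelow-suc h (suc k) = trans (cong (h 0 +_) (sumBelow-suc (h ∘ suc) k)) (sym (+-assoc (h 0) _ _))

sumBelow-zero : ∀ h k → (∀ x → x < k → h x ≡ 0) → sumBelow h k ≡ 0
sumBelow-zero h zero    _ = refl
sumBelow-zero h (suc k) z = trans (sumBelow-suc h k)
  (cong₂ _+_ (sumBelow-zero h k (λ x x<k → z x (m<n⇒m<1+n x<k))) (z k ≤-refl))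

sumBelow-stable : ∀ h K k → (∀ x → K ≤ x → h x ≡ 0) → K ≤ k → sumBelow h k ≡ sumBelow h K
sumBelow-stable h K zero    _ z≤n = refl
sumBelow-stable h K (suc k) z K≤k with m≤n⇒m<n∨m≡n K≤k
... | inj₂ refl = refl
... | inj₁ K<1+k = trans (sumBelow-suc h k)
  (trans (cong₂ _+_ (sumBelow-stable h K k z (≤-pred K<1+k)) (z k (≤-pred K<1+k))) (+-identityʳ _))

sum-tabulate≡sumBelow : ∀ k (h : ℕ → ℕ) → sum (tabulate {n = k} (h ∘ toℕ)) ≡ sumBelow h k
sum-tabulate≡sumBelow zero    h = refl
sum-tabulate≡sumBelow (suc k) h = cong (h 0 +_) (sum-tabulate≡sumBelow k (h ∘ suc))

countBelow≡sumBelow : ∀ f K → countBelow f K ≡ sumBelow (indicator ∘ f) K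
countBelow≡sumBelow f K = trans (countᵇ≡sum (f ∘ toℕ) (allFin K))
  (trans (cong sum (map-tabulate {n = K} (λ i → i) (indicator ∘ f ∘ toℕ)))
         (sum-tabulate≡sumBelow K (indicator ∘ f)))

countBelow-≡ᵇ : ∀ K (a : Fin K) → countBelow (_≡ᵇ toℕ a) K ≡ 1
countBelow-≡ᵇ K a = begin
  countBelow (_≡ᵇ toℕ a) K              ≡⟨ countBelow≡sumBelow _ K ⟩
  sumBelow h K                          ≡⟨ sumBelow-stable h (suc (toℕ a)) K above (toℕ<n a) ⟩
  sumBelow h (suc (toℕ a))              ≡⟨ sumBelow-suc h (toℕ a) ⟩
  sumBelow h (toℕ a) + h (toℕ a)        ≡⟨ cong₂ _+_ (sumBelow-zero h (toℕ a) below) (cong indicator (≡ᵇ-refl (toℕ a))) ⟩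
  1                                     ∎
  where
  open ≡-Reasoning
  h : ℕ → ℕ
  h t = indicator (t ≡ᵇ toℕ a)
  below : ∀ x → x < toℕ a → h x ≡ 0
  below x x<a = cong indicator (≢⇒≡ᵇ≡false x (toℕ a) (λ e → <-irrefl e x<a))
  above : ∀ x → suc (toℕ a) ≤ x → h x ≡ 0
  above x a<x = cong indicator (≢⇒≡ᵇ≡false x (toℕ a) (λ e → <-irrefl (sym e) a<x))

∉-prefix : ∀ {A : Set} (as : List A) {x bs} → Unique (as ++ x ∷ bs) → x ∉ as
∉-prefix (a ∷ as) (a≢ ∷ _) (here refl) = All.lookup a≢ (∈-insert as) refl
∉-prefix (a ∷ as) (_ ∷ u)  (there x∈as) = ∉-prefix as u x∈as

Unique⇒length≤ : ∀ {A : Set} (xs ys : List A) → Unique xs → (∀ {z} → z ∈ xs → z ∈ ys) →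
  length xs ≤ length ys
Unique⇒length≤ []       ys _          _   = z≤n
Unique⇒length≤ (x ∷ xs) ys (x≢ ∷ u) sub with ∈-∃++ (sub (here refl))
... | as , bs , refl = ≤-trans (s≤s (Unique⇒length≤ xs (as ++ bs) u sub′)) (≤-reflexive len)
  where
  sub′ : ∀ {z} → z ∈ xs → z ∈ as ++ bs
  sub′ z∈xs with ∈-++⁻ as (sub (there z∈xs))
  ... | inj₁ z∈as         = ∈-++⁺ˡ z∈as
  ... | inj₂ (here refl)  = ⊥-elim (All.lookup x≢ z∈xs refl)
  ... | inj₂ (there z∈bs) = ∈-++⁺ʳ as z∈bs
  len : suc (length (as ++ bs)) ≡ length (as ++ x ∷ bs)
  len = begin
    suc (length (as ++ bs))        ≡⟨ cong suc (length-++ as) ⟩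
    suc (length as + length bs)    ≡⟨ +-suc (length as) (length bs) ⟨
    length as + length (x ∷ bs)    ≡⟨ length-++ as ⟨
    length (as ++ x ∷ bs)          ∎
    where open ≡-Reasoning

Unique-complete : ∀ {n} (xs : List (Fin n)) → Unique xs → length xs ≡ n → ∀ k → k ∈ xs
Unique-complete {n} xs u len k with k ∈? xs
  where open import Data.List.Membership.DecPropositional _≟ᶠ_ using (_∈?_)
... | yes k∈xs = k∈xs
... | no  k∉xs = ⊥-elim (<-irrefl refl (≤-trans
        (Unique⇒length≤ (k ∷ xs) (allFin n) (¬Any⇒All¬ xs k∉xs ∷ u) (λ {z} _ → ∈-allFin z))
        (≤-reflexive (trans (length-tabulate (λ i → i)) (sym len)))))

Unique-complete⇒↭allFin : ∀ {n} (xs : List (Fin n)) → Unique xs → (∀ k → k ∈ xs) → xs ↭ allFin n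
Unique-complete⇒↭allFin {n} xs u complete =
  ∼bag⇒↭ (unique∧set⇒bag u (allFin⁺ n) (λ {z} → mk⇔ (λ _ → ∈-allFin z) (λ _ → complete z)))

distinct⇒Unique : ∀ {n} (xs : List (Fin n)) → distinct xs ≡ true → Unique xs
distinct⇒Unique []       _ = []
distinct⇒Unique (a ∷ as) e with ∧≡true⇒ {not (any (λ b → toℕ a ≡ᵇ toℕ b) as)} e
... | a∉as , d = All.tabulate a≢ ∷ distinct⇒Unique as d
  where
  a≢ : ∀ {b} → b ∈ as → a ≢ b
  a≢ b∈as refl with () ← trans (sym (cong not (any-∈ (λ b → toℕ a ≡ᵇ toℕ b) b∈as (≡ᵇ-refl (toℕ a))))) a∉as

Unique⇒distinct : ∀ {n} (xs : List (Fin n)) → Unique xs → distinct xs ≡ true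
Unique⇒distinct []       _          = refl
Unique⇒distinct (a ∷ as) (a≢ ∷ u) =
  subst (λ b → not b ∧ distinct as ≡ true) (sym (any-none (λ b → toℕ a ≡ᵇ toℕ b) as ≢ᵇ)) (Unique⇒distinct as u)
  where
  ≢ᵇ : ∀ b → b ∈ as → (toℕ a ≡ᵇ toℕ b) ≡ false
  ≢ᵇ b b∈as = ≢⇒≡ᵇ≡false (toℕ a) (toℕ b) (All.lookup a≢ b∈as ∘ toℕ-injective)

IncreasingBy : ∀ {A : Set} → (A → ℕ) → List A → Set
IncreasingBy key = AllPairs (λ a b → key a < key b)

strictlyIncreasing⇒IncreasingBy : ∀ {A : Set} (key : A → ℕ) xs →
  strictlyIncreasing (map key xs) ≡ true → IncreasingBy key xs
strictlyIncreasing⇒IncreasingBy key []           _ = []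
strictlyIncreasing⇒IncreasingBy key (a ∷ [])     _ = [] ∷ []
strictlyIncreasing⇒IncreasingBy key (a ∷ b ∷ xs) e =
  extend (<ᵇ⇒< (key a) (key b) (≡true⇒T (proj₁ (∧≡true⇒ {key a <ᵇ key b} e))))
         (strictlyIncreasing⇒IncreasingBy key (b ∷ xs) (proj₂ (∧≡true⇒ {key a <ᵇ key b} e)))
  where
  extend : key a < key b → IncreasingBy key (b ∷ xs) → IncreasingBy key (a ∷ b ∷ xs)
  extend a<b (b< ∷ inc) = (a<b ∷ All.map (<-trans a<b) b<) ∷ b< ∷ inc

IncreasingBy⇒strictlyIncreasing : ∀ {A : Set} (key : A → ℕ) xs →
  IncreasingBy key xs → strictlyIncreasing (map key xs) ≡ true
IncreasingBy⇒strictlyIncreasing key []           _                    = refl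
IncreasingBy⇒strictlyIncreasing key (a ∷ [])     _                    = refl
IncreasingBy⇒strictlyIncreasing key (a ∷ b ∷ xs) ((a<b ∷ _) ∷ inc) =
  subst (λ t → t ∧ strictlyIncreasing (map key (b ∷ xs)) ≡ true) (sym (T⇒≡true (<⇒<ᵇ a<b)))
        (IncreasingBy⇒strictlyIncreasing key (b ∷ xs) inc)

IncreasingBy⇒Unique : ∀ {A : Set} (key : A → ℕ) {xs} → IncreasingBy key xs → Unique xs
IncreasingBy⇒Unique key = AllPairs.map (λ a<b a≡b → <-irrefl (cong key a≡b) a<b)

IncreasingBy-sameElements⇒≡ : ∀ {A : Set} (key : A → ℕ) xs ys → IncreasingBy key xs → IncreasingBy key ys →
  (∀ {z} → z ∈ xs → z ∈ ys) → (∀ {z} → z ∈ ys → z ∈ xs) → xs ≡ ys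
IncreasingBy-sameElements⇒≡ key []       []       _ _ _ _ = refl
IncreasingBy-sameElements⇒≡ key []       (y ∷ ys) _ _ _ ⊇ with () ← ⊇ (here refl)
IncreasingBy-sameElements⇒≡ key (x ∷ xs) []       _ _ ⊆ _ with () ← ⊆ (here refl)
IncreasingBy-sameElements⇒≡ key (x ∷ xs) (y ∷ ys) (x< ∷ incx) (y< ∷ incy) ⊆ ⊇ =
  cong₂ _∷_ x≡y (IncreasingBy-sameElements⇒≡ key xs ys incx incy ⊆′ ⊇′)
  where
  x≡y : x ≡ y
  x≡y with ⊆ (here refl) | ⊇ (here refl)
  ... | here x≡y   | _          = x≡y
  ... | there _    | here y≡x   = sym y≡x
  ... | there x∈ys | there y∈xs = ⊥-elim (<-asym (All.lookup y< x∈ys) (All.lookup x< y∈xs))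
  ⊆′ : ∀ {z} → z ∈ xs → z ∈ ys
  ⊆′ z∈xs with ⊆ (there z∈xs)
  ... | here refl  = ⊥-elim (<-irrefl (cong key x≡y) (All.lookup x< z∈xs))
  ... | there z∈ys = z∈ys
  ⊇′ : ∀ {z} → z ∈ ys → z ∈ xs
  ⊇′ z∈ys with ⊇ (there z∈ys)
  ... | here refl  = ⊥-elim (<-irrefl (cong key (sym x≡y)) (All.lookup y< z∈ys))
  ... | there z∈xs = z∈xs

module InsertionSort {n : ℕ} (key : Fin n → ℕ) (key-injective : ∀ a b → key a ≡ key b → a ≡ b) where

  insert : ∀ {k} → Fin n → Vec (Fin n) k → Vec (Fin n) (suc k)
  insert a []      = a ∷ []
  insert a (b ∷ v) with key a ≤? key b
  ... | yes _ = a ∷ b ∷ v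
  ... | no  _ = b ∷ insert a v

  insert-↭ : ∀ {k} a (v : Vec (Fin n) k) → toList (insert a v) ↭ a ∷ toList v
  insert-↭ a []      = ↭-refl
  insert-↭ a (b ∷ v) with key a ≤? key b
  ... | yes _ = ↭-refl
  ... | no  _ = ↭-trans (prep b (insert-↭ a v)) (swap b a ↭-refl)

  insert-increasing : ∀ {k} a (v : Vec (Fin n) k) → a ∉ toList v → IncreasingBy key (toList v) →
    IncreasingBy key (toList (insert a v))
  insert-increasing a []      _   _             = [] ∷ []
  insert-increasing a (b ∷ v) a∉ (b< ∷ inc) with key a ≤? key b
  ... | yes a≤b = (a<b ∷ All.map (<-trans a<b) b<) ∷ b< ∷ inc
    where
    a<b : key a < key b
    a<b with m≤n⇒m<n∨m≡n a≤b
    ... | inj₁ a<b = a<b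
    ... | inj₂ a≡b = ⊥-elim (a∉ (here (key-injective a b a≡b)))
  ... | no a≰b = All.tabulate b<insert ∷ insert-increasing a v (a∉ ∘ there) inc
    where
    b<insert : ∀ {z} → z ∈ toList (insert a v) → key b < key z
    b<insert z∈ with ∈-resp-↭ (insert-↭ a v) z∈
    ... | here refl = ≰⇒> a≰b
    ... | there z∈v = All.lookup b< z∈v

  sort : ∀ {k} → Vec (Fin n) k → Vec (Fin n) k
  sort []      = []
  sort (a ∷ v) = insert a (sort v)

  sort-↭ : ∀ {k} (v : Vec (Fin n) k) → toList (sort v) ↭ toList v
  sort-↭ []      = ↭-refl
  sort-↭ (a ∷ v) = ↭-trans (insert-↭ a (sort v)) (prep a (sort-↭ v))

  sort-increasing : ∀ {k} (v : Vec (Fin n) k) → Unique (toList v) → IncreasingBy key (toList (sort v))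
  sort-increasing []      _          = []
  sort-increasing (a ∷ v) (a≢ ∷ u) =
    insert-increasing a (sort v) (λ a∈ → All.lookup a≢ (∈-resp-↭ (sort-↭ v) a∈) refl) (sort-increasing v u)

toList-injective : ∀ {A : Set} {k} (u v : Vec A k) → toList u ≡ toList v → u ≡ v
toList-injective []      []      _ = refl
toList-injective (a ∷ u) (b ∷ v) e = cong₂ _∷_ (∷-injectiveˡ e) (toList-injective u v (∷-injectiveʳ e))

toList-tabulate : ∀ {A : Set} {k} (f : Fin k → A) → toList (Vec.tabulate f) ≡ tabulate f
toList-tabulate {k = zero}  f = refl
toList-tabulate {k = suc k} f = cong (f fzero ∷_) (toList-tabulate (f ∘ fsuc))

toList≡map-lookup : ∀ {A : Set} {k} (v : Vec A k) → toList v ≡ map (lookup v) (allFin k)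
toList≡map-lookup {k = k} v = begin
  toList v                              ≡⟨ cong toList (Vec.tabulate∘lookup v) ⟨
  toList (Vec.tabulate (lookup v))      ≡⟨ toList-tabulate (lookup v) ⟩
  tabulate (lookup v)                   ≡⟨ map-tabulate {n = k} (λ i → i) (lookup v) ⟨
  map (lookup v) (allFin k)             ∎
  where open ≡-Reasoning

Vec-ext : ∀ {A : Set} {k} (u v : Vec A k) → (∀ i → lookup u i ≡ lookup v i) → u ≡ v
Vec-ext u v h = trans (sym (Vec.tabulate∘lookup u)) (trans (Vec.tabulate-cong h) (Vec.tabulate∘lookup v))

-- The parking process

-- Defs' blockFree and firstFit see the occupied intervals only through occupied;
-- abstracting to an occupancy predicate lets the blocks of earlier cars be added freely.

inBlock : ℕ → ℕ → ℕ → Bool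
inBlock p L t = (p ≤ᵇ t) ∧ (t <ᵇ p + L)

inBlock⇒ : ∀ p L t → inBlock p L t ≡ true → p ≤ t × t < p + L
inBlock⇒ p L t e with ∧≡true⇒ {p ≤ᵇ t} e
... | p≤t , t<p+L = ≤ᵇ⇒≤ p t (≡true⇒T p≤t) , <ᵇ⇒< t (p + L) (≡true⇒T t<p+L)

inBlock-intro : ∀ p L t → p ≤ t → t < p + L → inBlock p L t ≡ true
inBlock-intro p L t p≤t t<p+L rewrite T⇒≡true (≤⇒≤ᵇ p≤t) | T⇒≡true (<⇒<ᵇ t<p+L) = refl

inBlock-false : ∀ p L t → (p ≤ t → t < p + L → ⊥) → inBlock p L t ≡ false
inBlock-false p L t h with inBlock p L t in eq
... | false = refl
... | true  = ⊥-elim (h (proj₁ (inBlock⇒ p L t eq)) (proj₂ (inBlock⇒ p L t eq)))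

blockFreeᵒ : (ℕ → Bool) → ℕ → ℕ → Bool
blockFreeᵒ O p zero    = true
blockFreeᵒ O p (suc L) = not (O p) ∧ blockFreeᵒ O (suc p) L

fitsᵒ : ℕ → (ℕ → Bool) → ℕ → ℕ → Bool
fitsᵒ m O L p = (p + L ≤ᵇ m) ∧ blockFreeᵒ O p L

firstFitᵒ : ℕ → (ℕ → Bool) → ℕ → ℕ → ℕ → Maybe ℕ
firstFitᵒ m O L p zero       = nothing
firstFitᵒ m O L p (suc fuel) = if fitsᵒ m O L p then just p else firstFitᵒ m O L (suc p) fuel

blockFree≡blockFreeᵒ : ∀ occ p L → blockFree occ p L ≡ blockFreeᵒ (occupied occ) p L
blockFree≡blockFreeᵒ occ p zero    = refl
blockFree≡blockFreeᵒ occ p (suc L) = cong (not (occupied occ p) ∧_) (blockFree≡blockFreeᵒ occ (suc p) L)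

firstFit≡firstFitᵒ : ∀ m occ L p fuel → firstFit m occ L p fuel ≡ firstFitᵒ m (occupied occ) L p fuel
firstFit≡firstFitᵒ m occ L p zero = refl
firstFit≡firstFitᵒ m occ L p (suc fuel)
  rewrite blockFree≡blockFreeᵒ occ p L | firstFit≡firstFitᵒ m occ L (suc p) fuel = refl

blockFreeᵒ-cong : ∀ {O O′ : ℕ → Bool} → (∀ t → O t ≡ O′ t) → ∀ p L → blockFreeᵒ O p L ≡ blockFreeᵒ O′ p L
blockFreeᵒ-cong e p zero    = refl
blockFreeᵒ-cong e p (suc L) = cong₂ (λ a b → not a ∧ b) (e p) (blockFreeᵒ-cong e (suc p) L)

firstFitᵒ-cong : ∀ {O O′ : ℕ → Bool} → (∀ t → O t ≡ O′ t) → ∀ m L p fuel →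
  firstFitᵒ m O L p fuel ≡ firstFitᵒ m O′ L p fuel
firstFitᵒ-cong e m L p zero = refl
firstFitᵒ-cong e m L p (suc fuel) rewrite blockFreeᵒ-cong e p L | firstFitᵒ-cong e m L (suc p) fuel = refl

blockFreeᵒ⇒free : ∀ O p L → blockFreeᵒ O p L ≡ true → ∀ t → p ≤ t → t < p + L → O t ≡ false
blockFreeᵒ⇒free O p zero    _ t p≤t t<p+0 = ⊥-elim (<-irrefl refl (<-≤-trans t<p+0 (≤-trans (≤-reflexive (+-identityʳ p)) p≤t)))
blockFreeᵒ⇒free O p (suc L) e t p≤t t<p+L with ∧≡true⇒ {not (O p)} e | m≤n⇒m<n∨m≡n p≤t
... | Op≡false , _    | inj₂ refl = not-injective Op≡false
  where
  not-injective : ∀ {x} → not x ≡ true → x ≡ false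
  not-injective {false} _ = refl
... | _        , free | inj₁ p<t  = blockFreeᵒ⇒free O (suc p) L free t p<t (subst (t <_) (+-suc p L) t<p+L)

free⇒blockFreeᵒ : ∀ O p L → (∀ t → p ≤ t → t < p + L → O t ≡ false) → blockFreeᵒ O p L ≡ true
free⇒blockFreeᵒ O p zero    _ = refl
free⇒blockFreeᵒ O p (suc L) h rewrite h p ≤-refl (m<m+n p z<s) =
  free⇒blockFreeᵒ O (suc p) L (λ t p<t t<p+L → h t (≤-trans (n≤1+n p) p<t) (subst (t <_) (sym (+-suc p L)) t<p+L))

firstFitᵒ≡just⇒ : ∀ m O L p fuel r → firstFitᵒ m O L p fuel ≡ just r →
  p ≤ r × (∀ q → p ≤ q → q < r → fitsᵒ m O L q ≡ false) × fitsᵒ m O L r ≡ true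
firstFitᵒ≡just⇒ m O L p (suc fuel) r e with fitsᵒ m O L p in fits
... | true with refl ← e = ≤-refl , (λ q p≤q q<p → ⊥-elim (<-irrefl refl (<-≤-trans q<p p≤q))) , fits
... | false with firstFitᵒ≡just⇒ m O L (suc p) fuel r e
...   | p<r , before , fitsʳ = ≤-trans (n≤1+n p) p<r , before′ , fitsʳ
  where
  before′ : ∀ q → p ≤ q → q < r → fitsᵒ m O L q ≡ false
  before′ q p≤q q<r with m≤n⇒m<n∨m≡n p≤q
  ... | inj₂ refl = fits
  ... | inj₁ p<q  = before q p<q q<r

firstFitᵒ-returns-first : ∀ m O L S p fuel → fitsᵒ m O L S ≡ true → p ≤ S → S < p + fuel →
  (∀ q → p ≤ q → q < S → fitsᵒ m O L q ≡ false) → firstFitᵒ m O L p fuel ≡ just S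
firstFitᵒ-returns-first m O L S p zero _ p≤S S<p+0 _ =
  ⊥-elim (<-irrefl refl (<-≤-trans S<p+0 (≤-trans (≤-reflexive (+-identityʳ p)) p≤S)))
firstFitᵒ-returns-first m O L S p (suc fuel) fits p≤S S<p+fuel before with m≤n⇒m<n∨m≡n p≤S
... | inj₂ refl rewrite fits = refl
... | inj₁ p<S rewrite before p ≤-refl p<S =
  firstFitᵒ-returns-first m O L S (suc p) fuel fits p<S (subst (S <_) (+-suc p fuel) S<p+fuel)
    (λ q p<q q<S → before q (≤-trans (n≤1+n p) p<q) q<S)

record Placement (m : ℕ) (occ : Occ) {k} (Ls ps : Vec ℕ k) : Set where
  field
    within   : ∀ j → lookup ps j + lookup Ls j ≤ m
    avoids   : ∀ j t → inBlock (lookup ps j) (lookup Ls j) t ≡ true → occupied occ t ≡ false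
    disjoint : ∀ i j → i ≢ j → ∀ t → inBlock (lookup ps i) (lookup Ls i) t ≡ true →
               inBlock (lookup ps j) (lookup Ls j) t ≡ false

parkFrom-placement : ∀ m occ {k} (xs Ls : Vec ℕ k) ps → parkFrom m occ xs Ls ≡ just ps → Placement m occ Ls ps
parkFrom-placement m occ [] [] [] _ = record { within = λ () ; avoids = λ () ; disjoint = λ () }
parkFrom-placement m occ (x ∷ xs) (L ∷ Ls) ps e with firstFit m occ L x (suc m) in ff
... | just p with parkFrom m ((p , L) ∷ occ) xs Ls in rest
...   | just ps′ with refl ← just-injective e = record { within = within ; avoids = avoids ; disjoint = disjoint }
  where
  module IH = Placement (parkFrom-placement m ((p , L) ∷ occ) xs Ls ps′ rest)
  fits : fitsᵒ m (occupied occ) L p ≡ true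
  fits = proj₂ (proj₂ (firstFitᵒ≡just⇒ m (occupied occ) L x (suc m) p (trans (sym (firstFit≡firstFitᵒ m occ L x (suc m))) ff)))
  within : ∀ j → lookup (p ∷ ps′) j + lookup (L ∷ Ls) j ≤ m
  within fzero    = ≤ᵇ⇒≤ (p + L) m (≡true⇒T (proj₁ (∧≡true⇒ {p + L ≤ᵇ m} fits)))
  within (fsuc j) = IH.within j
  avoids : ∀ j t → inBlock (lookup (p ∷ ps′) j) (lookup (L ∷ Ls) j) t ≡ true → occupied occ t ≡ false
  avoids fzero t t∈ = blockFreeᵒ⇒free (occupied occ) p L (proj₂ (∧≡true⇒ {p + L ≤ᵇ m} fits)) t
                        (proj₁ (inBlock⇒ p L t t∈)) (proj₂ (inBlock⇒ p L t t∈))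
  avoids (fsuc j) t t∈ = proj₂ (∨≡false⇒ {inBlock p L t} (IH.avoids j t t∈))
  disjoint : ∀ i j → i ≢ j → ∀ t → inBlock (lookup (p ∷ ps′) i) (lookup (L ∷ Ls) i) t ≡ true →
             inBlock (lookup (p ∷ ps′) j) (lookup (L ∷ Ls) j) t ≡ false
  disjoint fzero    fzero    i≢j _ _  = ⊥-elim (i≢j refl)
  disjoint fzero    (fsuc j) _   t t∈ with inBlock (lookup ps′ j) (lookup Ls j) t in t∈j
  ... | false = refl
  ... | true with () ← trans (sym t∈) (proj₁ (∨≡false⇒ {inBlock p L t} (IH.avoids j t t∈j)))
  disjoint (fsuc i) fzero    _   t t∈ = proj₁ (∨≡false⇒ {inBlock p L t} (IH.avoids i t t∈))
  disjoint (fsuc i) (fsuc j) i≢j t t∈ = IH.disjoint i j (i≢j ∘ cong fsuc) t t∈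

eqJust : Maybe ℕ → ℕ → Bool
eqJust nothing  t = false
eqJust (just a) t = a ≡ᵇ t

eqJust⇒≡ : ∀ r t → eqJust r t ≡ true → r ≡ just t
eqJust⇒≡ (just a) t e = cong just (≡ᵇ⇒≡ a t (≡true⇒T e))

-- The j-th predicate holds of a preference x iff car j, arriving after cars 0, …, j-1
-- have parked at their positions in T, parks at position T j.
landsAt : ∀ {k} → ℕ → Occ → Vec ℕ k → Vec ℕ k → Vec (ℕ → Bool) k
landsAt m occ []      []       = []
landsAt m occ (t ∷ T) (L ∷ Ls) = (λ x → eqJust (firstFit m occ L x (suc m)) t) ∷ landsAt m ((t , L) ∷ occ) T Ls

landsAt-sound : ∀ m occ {k} (T Ls xs : Vec ℕ k) → pointwiseᵇ (landsAt m occ T Ls) xs ≡ true →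
  parkFrom m occ xs Ls ≡ just T
landsAt-sound m occ []      []       []       _ = refl
landsAt-sound m occ (t ∷ T) (L ∷ Ls) (x ∷ xs) e with ∧≡true⇒ {eqJust (firstFit m occ L x (suc m)) t} e
... | first , rest
  rewrite eqJust⇒≡ (firstFit m occ L x (suc m)) t first | landsAt-sound m ((t , L) ∷ occ) T Ls xs rest = refl

landsAt-complete : ∀ m occ {k} (T Ls xs : Vec ℕ k) → parkFrom m occ xs Ls ≡ just T →
  pointwiseᵇ (landsAt m occ T Ls) xs ≡ true
landsAt-complete m occ []      []       []       _ = refl
landsAt-complete m occ (t ∷ T) (L ∷ Ls) (x ∷ xs) e with firstFit m occ L x (suc m)
... | just p with parkFrom m ((p , L) ∷ occ) xs Ls in rest
...   | just ps′ with refl ← just-injective e rewrite ≡ᵇ-refl p = landsAt-complete m ((p , L) ∷ occ) ps′ Ls xs rest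

occupiedBefore : ∀ {k} → Fin k → Vec ℕ k → Vec ℕ k → ℕ → Bool
occupiedBefore fzero    _       _        t = false
occupiedBefore (fsuc j) (a ∷ T) (L ∷ Ls) t = inBlock a L t ∨ occupiedBefore j T Ls t

lookup-landsAt : ∀ m occ {k} (T Ls : Vec ℕ k) j x →
  lookup (landsAt m occ T Ls) j x ≡
    eqJust (firstFitᵒ m (λ t → occupied occ t ∨ occupiedBefore j T Ls t) (lookup Ls j) x (suc m)) (lookup T j)
lookup-landsAt m occ (t ∷ T) (L ∷ Ls) fzero x =
  cong (λ r → eqJust r t) (trans (firstFit≡firstFitᵒ m occ L x (suc m))
    (firstFitᵒ-cong (λ s → sym (∨-identityʳ (occupied occ s))) m L x (suc m)))
lookup-landsAt m occ (t ∷ T) (L ∷ Ls) (fsuc j) x =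
  trans (lookup-landsAt m ((t , L) ∷ occ) T Ls j x)
    (cong (λ r → eqJust r (lookup T j)) (firstFitᵒ-cong regroup m (lookup Ls j) x (suc m)))
  where
  regroup : ∀ s → (inBlock t L s ∨ occupied occ s) ∨ occupiedBefore j T Ls s ≡
                  occupied occ s ∨ (inBlock t L s ∨ occupiedBefore j T Ls s)
  regroup s = trans (∨-assoc (inBlock t L s) (occupied occ s) _)
    (trans (cong (inBlock t L s ∨_) (∨-comm (occupied occ s) (occupiedBefore j T Ls s)))
    (trans (sym (∨-assoc (inBlock t L s) (occupiedBefore j T Ls s) _)) (∨-comm _ (occupied occ s))))

occupiedBefore≡any : ∀ {k} (j : Fin k) (T Ls : Vec ℕ k) t →
  occupiedBefore j T Ls t ≡ any (λ i → (toℕ i <ᵇ toℕ j) ∧ inBlock (lookup T i) (lookup Ls i) t) (allFin k)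
occupiedBefore≡any {suc k} fzero    (a ∷ T) (L ∷ Ls) t = sym (any-none (λ _ → false) (allFin (suc k)) (λ _ _ → refl))
occupiedBefore≡any {suc k} (fsuc j) (a ∷ T) (L ∷ Ls) t =
  cong (inBlock a L t ∨_) (trans (occupiedBefore≡any j T Ls t)
    (sym (any-tabulate (λ i → (toℕ i <ᵇ suc (toℕ j)) ∧ inBlock (lookup (a ∷ T) i) (lookup (L ∷ Ls) i) t) fsuc)))

-- Counting the preferences that slide into a given free block

extendRun : Bool → ℕ → ℕ
extendRun true  r = 0
extendRun false r = suc r

-- Reading occupancy bits leftwards from a free block, with r the length of the free run
-- to the right of the current spot, count the spots passed before a free run of length L
-- appears; a car of length L preferring one of them slides right into the free block.
reach : ℕ → ℕ → List Bool → ℕ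
reach L r []       = 0
reach L r (b ∷ bs) = if L ≤ᵇ extendRun b r then 0 else suc (reach L (extendRun b r) bs)

-- bs lists the values of O at q-1, q-2, …, 0.
DescribesBelow : (ℕ → Bool) → List Bool → ℕ → Set
DescribesBelow O []       q       = q ≡ 0
DescribesBelow O (b ∷ bs) zero    = ⊥
DescribesBelow O (b ∷ bs) (suc q) = O q ≡ b × DescribesBelow O bs q

DescribesBelow-cong : ∀ O O′ bs q → (∀ t → t < q → O t ≡ O′ t) → DescribesBelow O bs q → DescribesBelow O′ bs q
DescribesBelow-cong O O′ []       q       _ d        = d
DescribesBelow-cong O O′ (b ∷ bs) (suc q) h (Oq , d) =
  trans (sym (h q ≤-refl)) Oq , DescribesBelow-cong O O′ bs q (λ t t<q → h t (m<n⇒m<1+n t<q)) d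

DescribesBelow-replicate : ∀ O k q b bs → (∀ t → q ≤ t → t < k + q → O t ≡ b) →
  DescribesBelow O bs q → DescribesBelow O (replicate k b ++ bs) (k + q)
DescribesBelow-replicate O zero    q b bs _ d = d
DescribesBelow-replicate O (suc k) q b bs h d =
  h (k + q) (m≤n+m q k) ≤-refl , DescribesBelow-replicate O k q b bs (λ t q≤t t<k+q → h t q≤t (m<n⇒m<1+n t<k+q)) d

FreeRun : (ℕ → Bool) → ℕ → ℕ → ℕ → Set
FreeRun O L q r = ∀ k → k ≤ L → (blockFreeᵒ O q k ≡ true → k ≤ r) × (k ≤ r → blockFreeᵒ O q k ≡ true)

FreeRun-step : ∀ O L q r → FreeRun O L (suc q) r → FreeRun O L q (extendRun (O q) r)
FreeRun-step O L q r run zero    _ = (λ _ → z≤n) , (λ _ → refl)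
FreeRun-step O L q r run (suc k) k<L with O q
... | true  = (λ ()) , (λ ())
... | false = (λ free → s≤s (proj₁ (run k (≤-trans (n≤1+n k) k<L)) free))
            , (λ k<r → proj₂ (run k (≤-trans (n≤1+n k) k<L)) (≤-pred k<r))

module Landing (m : ℕ) (O : ℕ → Bool) (L S : ℕ) (1≤L : 1 ≤ L) (S+L≤m : S + L ≤ m)
               (free : ∀ t → S ≤ t → t < S + L → O t ≡ false) where

  lands : ℕ → Bool
  lands x = eqJust (firstFitᵒ m O L x (suc m)) S

  landsℕ : ℕ → ℕ
  landsℕ = indicator ∘ lands

  fits-S : fitsᵒ m O L S ≡ true
  fits-S rewrite T⇒≡true (≤⇒≤ᵇ S+L≤m) = free⇒blockFreeᵒ O S L free

  fits-below : ∀ q → q < S → fitsᵒ m O L q ≡ blockFreeᵒ O q L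
  fits-below q q<S rewrite T⇒≡true (≤⇒≤ᵇ (≤-trans (+-monoˡ-≤ L (<⇒≤ q<S)) S+L≤m)) = refl

  lands⇒ : ∀ x → lands x ≡ true → x ≤ S × (∀ q → x ≤ q → q < S → fitsᵒ m O L q ≡ false)
  lands⇒ x e with firstFitᵒ≡just⇒ m O L x (suc m) S (eqJust⇒≡ _ S e)
  ... | x≤S , before , _ = x≤S , before

  lands-intro : ∀ x → x ≤ S → (∀ q → x ≤ q → q < S → fitsᵒ m O L q ≡ false) → lands x ≡ true
  lands-intro x x≤S before =
    subst (λ r → eqJust r S ≡ true) (sym (firstFitᵒ-returns-first m O L S x (suc m) fits-S x≤S S<x+m+1 before)) (≡ᵇ-refl S)
    where
    S<x+m+1 : S < x + suc m
    S<x+m+1 = ≤-trans (s≤s (≤-trans (m≤m+n S L) S+L≤m)) (m≤n+m (suc m) x)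

  nothing-above : ∀ x → suc S ≤ x → landsℕ x ≡ 0
  nothing-above x S<x with lands x in e
  ... | false = refl
  ... | true  = ⊥-elim (<-irrefl refl (<-≤-trans S<x (proj₁ (lands⇒ x e))))

  nothing-below-fit : ∀ q → q < S → fitsᵒ m O L q ≡ true → ∀ x → x < suc q → landsℕ x ≡ 0
  nothing-below-fit q q<S fits x x≤q with lands x in e
  ... | false = refl
  ... | true with () ← trans (sym fits) (proj₂ (lands⇒ x e) q (≤-pred x≤q) q<S)

  sumBelow-reach : ∀ bs q r → DescribesBelow O bs q → q ≤ S → (∀ q′ → q ≤ q′ → q′ < S → fitsᵒ m O L q′ ≡ false) →
    FreeRun O L q r → sumBelow landsℕ q ≡ reach L r bs
  sumBelow-reach []       q       r d        _   _      _   = cong (sumBelow landsℕ) d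
  sumBelow-reach (b ∷ bs) (suc q) r (Oq , d) q<S before run with L ≤ᵇ extendRun b r in L≤run
  ... | true = sumBelow-zero landsℕ (suc q) (nothing-below-fit q q<S fits)
    where
    fits : fitsᵒ m O L q ≡ true
    fits = trans (fits-below q q<S) (proj₂ (run′ L ≤-refl) (≤ᵇ⇒≤ L (extendRun b r) (≡true⇒T L≤run)))
      where run′ = subst (λ z → FreeRun O L q (extendRun z r)) Oq (FreeRun-step O L q r run)
  ... | false = trans (sumBelow-suc landsℕ q) (trans (cong₂ _+_ rest (cong indicator lands-q)) (+-comm _ 1))
    where
    run′ : FreeRun O L q (extendRun b r)
    run′ = subst (λ z → FreeRun O L q (extendRun z r)) Oq (FreeRun-step O L q r run)
    unfit : fitsᵒ m O L q ≡ false
    unfit with fitsᵒ m O L q in e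
    ... | false = refl
    ... | true with () ← trans (sym (T⇒≡true (≤⇒≤ᵇ (proj₁ (run′ L ≤-refl) (trans (sym (fits-below q q<S)) e))))) L≤run
    before′ : ∀ q′ → q ≤ q′ → q′ < S → fitsᵒ m O L q′ ≡ false
    before′ q′ q≤q′ q′<S with m≤n⇒m<n∨m≡n q≤q′
    ... | inj₂ refl = unfit
    ... | inj₁ q<q′ = before q′ q<q′ q′<S
    lands-q : lands q ≡ true
    lands-q = lands-intro q (<⇒≤ q<S) before′
    rest : sumBelow landsℕ q ≡ reach L (extendRun b r) bs
    rest = sumBelow-reach bs q (extendRun b r) d (<⇒≤ q<S) before′ run′

  countBelow-lands : ∀ bs → DescribesBelow O bs S → countBelow lands m ≡ suc (reach L L bs)
  countBelow-lands bs d = begin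
    countBelow lands m            ≡⟨ countBelow≡sumBelow lands m ⟩
    sumBelow landsℕ m                  ≡⟨ sumBelow-stable landsℕ (suc S) m nothing-above S<m ⟩
    sumBelow landsℕ (suc S)            ≡⟨ sumBelow-suc landsℕ S ⟩
    sumBelow landsℕ S + landsℕ S            ≡⟨ cong₂ _+_ (sumBelow-reach bs S L d ≤-refl none run) (cong indicator lands-S) ⟩
    reach L L bs + 1              ≡⟨ +-comm _ 1 ⟩
    suc (reach L L bs)            ∎
    where
    open ≡-Reasoning
    S<m : suc S ≤ m
    S<m = ≤-trans (≤-reflexive (+-comm 1 S)) (≤-trans (+-monoʳ-≤ S 1≤L) S+L≤m)
    none : ∀ q → S ≤ q → q < S → fitsᵒ m O L q ≡ false
    none q S≤q q<S = ⊥-elim (<-irrefl refl (<-≤-trans q<S S≤q))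
    run : FreeRun O L S L
    run k k≤L = (λ _ → k≤L) , (λ _ → free⇒blockFreeᵒ O S k (λ t S≤t t<S+k → free t S≤t (<-≤-trans t<S+k (+-monoʳ-≤ S k≤L))))
    lands-S : lands S ≡ true
    lands-S = lands-intro S ≤-refl none

-- The block decomposition read off the occupancy to the left of a car

HeadFails : ∀ {A : Set} → (A → Bool) → List A → Set
HeadFails p []      = ⊤
HeadFails p (a ∷ _) = p a ≡ false

Allᵇ : ∀ {A : Set} → (A → Bool) → List A → Set
Allᵇ p = All (λ a → p a ≡ true)

spanᵇ-spec : ∀ {A : Set} (p : A → Bool) xs →
  (xs ≡ proj₁ (spanᵇ p xs) ++ proj₂ (spanᵇ p xs)) × Allᵇ p (proj₁ (spanᵇ p xs)) × HeadFails p (proj₂ (spanᵇ p xs))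
spanᵇ-spec p []       = refl , [] , tt
spanᵇ-spec p (a ∷ as) with p a in pa
... | false = refl , [] , pa
... | true with spanᵇ p as | spanᵇ-spec p as
...   | (r , s) | (as≡ , all-r , head-s) = cong (a ∷_) as≡ , (pa ∷ all-r) , head-s

replicate-++ : ∀ {A : Set} j k (x : A) → replicate j x ++ replicate k x ≡ replicate (j + k) x
replicate-++ zero    k x = refl
replicate-++ (suc j) k x = cong (x ∷_) (replicate-++ j k x)

reach-trues : ∀ L k bs → 1 ≤ L → reach L 0 (replicate k true ++ bs) ≡ k + reach L 0 bs
reach-trues (suc L) zero    bs _   = refl
reach-trues (suc L) (suc k) bs 1≤L = cong suc (reach-trues (suc L) k bs 1≤L)

reach-true-head : ∀ L r r′ bs → 1 ≤ L → reach L r (true ∷ bs) ≡ reach L r′ (true ∷ bs)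
reach-true-head (suc L) r r′ bs _ = refl

reach-short-falses : ∀ L r k bs → r + k < L → reach L r (replicate k false ++ bs) ≡ k + reach L (r + k) bs
reach-short-falses L r zero    bs _ rewrite +-identityʳ r = refl
reach-short-falses L r (suc k) bs r+k<L with L ≤ᵇ suc r in L≤r
... | true  = ⊥-elim (<-irrefl refl (<-≤-trans r+k<L
                (≤-trans (≤ᵇ⇒≤ L (suc r) (≡true⇒T L≤r)) (≤-trans (s≤s (m≤m+n r k)) (≤-reflexive (sym (+-suc r k)))))))
... | false = cong suc (trans (reach-short-falses L (suc r) k bs (subst (_< L) (+-suc r k) r+k<L))
                              (cong (λ z → k + reach L z bs) (sym (+-suc r k))))

reach-long-falses : ∀ L r k bs → r < L → L ≤ r + k → reach L r (replicate k false ++ bs) ≡ L ∸ suc r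
reach-long-falses L r zero bs r<L L≤r+0 = ⊥-elim (<-irrefl refl (<-≤-trans r<L (≤-trans L≤r+0 (≤-reflexive (+-identityʳ r)))))
reach-long-falses (suc L) r (suc k) bs r<L L≤r+k with suc L ≤ᵇ suc r in L≤r
... | true  = sym (m≤n⇒m∸n≡0 (≤-pred (≤ᵇ⇒≤ (suc L) (suc r) (≡true⇒T L≤r))))
... | false = trans (cong suc (reach-long-falses (suc L) (suc r) k bs r+1<L (subst (suc L ≤_) (+-suc r k) L≤r+k)))
                    (sym (+-∸-assoc 1 (≤-pred r+1<L)))
  where
  r+1<L : suc r < suc L
  r+1<L with m≤n⇒m<n∨m≡n r<L
  ... | inj₁ r+1<L = r+1<L
  ... | inj₂ r+1≡L with () ← trans (sym (T⇒≡true (≤⇒≤ᵇ (≤-reflexive (sym r+1≡L))))) L≤r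

-- Seen from car c, the spots of the cars w (listed right to left) are occupied exactly
-- when the car entered before c.
occupancyBits : ∀ {n} → Vec ℕ n → Fin n → List (Fin n) → List Bool
occupancyBits y c []      = []
occupancyBits y c (a ∷ w) = replicate (lookup y a) (toℕ a <ᵇ toℕ c) ++ occupancyBits y c w

occupancyBits-++ : ∀ {n} (y : Vec ℕ n) c u v → occupancyBits y c (u ++ v) ≡ occupancyBits y c u ++ occupancyBits y c v
occupancyBits-++ y c []      v = refl
occupancyBits-++ y c (a ∷ u) v = trans (cong (replicate (lookup y a) (toℕ a <ᵇ toℕ c) ++_) (occupancyBits-++ y c u v))
  (sym (++-assoc (replicate (lookup y a) (toℕ a <ᵇ toℕ c)) (occupancyBits y c u) (occupancyBits y c v)))

occupancyBits-earlier : ∀ {n} (y : Vec ℕ n) c u → Allᵇ (λ a → toℕ a <ᵇ toℕ c) u →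
  occupancyBits y c u ≡ replicate (wt y u) true
occupancyBits-earlier y c []      _ = refl
occupancyBits-earlier y c (a ∷ u) (a<c ∷ u<c) rewrite a<c =
  trans (cong (replicate (lookup y a) true ++_) (occupancyBits-earlier y c u u<c)) (replicate-++ (lookup y a) _ true)

occupancyBits-later : ∀ {n} (y : Vec ℕ n) c u → Allᵇ (λ a → toℕ c <ᵇ toℕ a) u →
  occupancyBits y c u ≡ replicate (wt y u) false
occupancyBits-later y c []      _ = refl
occupancyBits-later y c (a ∷ u) (c<a ∷ c<u) rewrite <ᵇ-asym (toℕ c) (toℕ a) c<a =
  trans (cong (replicate (lookup y a) false ++_) (occupancyBits-later y c u c<u)) (replicate-++ (lookup y a) _ false)

wt-++ : ∀ {n} (y : Vec ℕ n) u v → wt y (u ++ v) ≡ wt y u + wt y v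
wt-++ y u v = trans (cong sum (map-++ (lookup y) u v)) (sum-++ (map (lookup y) u) (map (lookup y) v))

Excludes : ∀ {n} → Fin n → List (Fin n) → Set
Excludes c = All (λ a → toℕ a ≢ toℕ c)

Excludes-suffix : ∀ {n} (c : Fin n) u {v} → Excludes c (u ++ v) → Excludes c v
Excludes-suffix c []      ex       = ex
Excludes-suffix c (a ∷ u) (_ ∷ ex) = Excludes-suffix c u ex

-- The first car of w entered before c, so the run length carried in is forgotten.
reach-startIndependent : ∀ {n} (y : Vec ℕ n) → (∀ i → 1 ≤ lookup y i) → ∀ c w → Excludes c w →
  HeadFails (λ a → toℕ c <ᵇ toℕ a) w →
  ∀ r r′ → reach (lookup y c) r (occupancyBits y c w) ≡ reach (lookup y c) r′ (occupancyBits y c w)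
reach-startIndependent y ypos c []      _          _   r r′ = refl
reach-startIndependent y ypos c (a ∷ w) (a≢c ∷ _) c≮a r r′ with toℕ a <ᵇ toℕ c in a<c | lookup y a | ypos a
... | false | _     | _ = ⊥-elim (a≢c (≮ᵇ∧≯ᵇ⇒≡ (toℕ a) (toℕ c) a<c c≮a))
... | true  | suc k | _ = reach-true-head (lookup y c) r r′ (replicate k true ++ occupancyBits y c w) (ypos c)

reach-allEarlier : ∀ {n} (y : Vec ℕ n) c w → 1 ≤ lookup y c → Allᵇ (λ a → toℕ a <ᵇ toℕ c) w →
  reach (lookup y c) 0 (occupancyBits y c w) ≡ wt y w
reach-allEarlier y c w 1≤L w<c = begin
  reach L 0 (occupancyBits y c w)                ≡⟨ cong (reach L 0) (occupancyBits-earlier y c w w<c) ⟩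
  reach L 0 (replicate (wt y w) true)            ≡⟨ cong (reach L 0) (++-identityʳ (replicate (wt y w) true)) ⟨
  reach L 0 (replicate (wt y w) true ++ [])      ≡⟨ reach-trues L (wt y w) [] 1≤L ⟩
  wt y w + 0                                     ≡⟨ +-identityʳ _ ⟩
  wt y w                                         ∎
  where
  open ≡-Reasoning
  L : ℕ
  L = lookup y c

formula : ℕ → ℕ → Maybe ℕ → ℕ
formula L W nothing  = 1 + W
formula L W (just s) = L + s

-- One β-block followed by one α-block: either the α-block is long enough to hold the car
-- (m(i) is reached), or the count continues past it.
reach-block-bits : ∀ L b a B W M → 1 ≤ L → (∀ r r′ → reach L r B ≡ reach L r′ B) →
  suc (reach L 0 B) ≡ formula L W M →
  suc (b + reach L 0 (replicate a false ++ B)) ≡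
    formula L (b + (a + W)) (if L ≤ᵇ a then just b else Maybe.map (λ r → b + a + r) M)
reach-block-bits L b a B W M 1≤L independent ih with L ≤ᵇ a in L≤a
... | true = begin
  suc (b + reach L 0 (replicate a false ++ B))   ≡⟨ cong (λ z → suc (b + z)) (reach-long-falses L 0 a B 1≤L (≤ᵇ⇒≤ L a (≡true⇒T L≤a))) ⟩
  suc (b + (L ∸ 1))                              ≡⟨ lemma L 1≤L ⟩
  L + b                                          ∎
  where
  open ≡-Reasoning
  lemma : ∀ L → 1 ≤ L → suc (b + (L ∸ 1)) ≡ L + b
  lemma (suc L) _ = cong suc (+-comm b L)
... | false = begin
  suc (b + reach L 0 (replicate a false ++ B))   ≡⟨ cong (λ z → suc (b + z)) (reach-short-falses L 0 a B a<L) ⟩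
  suc (b + (a + reach L a B))                    ≡⟨ cong (λ z → suc (b + (a + z))) (independent a 0) ⟩
  suc (b + (a + reach L 0 B))                    ≡⟨ continue M ih ⟩
  formula L (b + (a + W)) (Maybe.map (λ r → b + a + r) M) ∎
  where
  open ≡-Reasoning
  a<L : a < L
  a<L = ≰⇒> (λ L≤a′ → case (trans (sym (T⇒≡true (≤⇒≤ᵇ L≤a′))) L≤a))
    where
    case : true ≡ false → ⊥
    case ()
  continue : (M : Maybe ℕ) → suc (reach L 0 B) ≡ formula L W M →
    suc (b + (a + reach L 0 B)) ≡ formula L (b + (a + W)) (Maybe.map (λ r → b + a + r) M)
  continue nothing  e = cong (λ z → suc (b + (a + z))) (suc-injective e)
  continue (just s) e = trans (shift b a (reach L 0 B)) (trans (cong (λ z → b + (a + z)) e) (regroup b a L s))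
    where
    shift : ∀ b a t → suc (b + (a + t)) ≡ b + (a + suc t)
    shift = solve-∀
    regroup : ∀ b a L s → b + (a + (L + s)) ≡ L + (b + a + s)
    regroup = solve-∀

reach-block : ∀ {n} (y : Vec ℕ n) → (∀ i → 1 ≤ lookup y i) → ∀ (c : Fin n) β α w →
  Allᵇ (λ a → toℕ a <ᵇ toℕ c) β → Allᵇ (λ a → toℕ c <ᵇ toℕ a) α →
  Excludes c w → HeadFails (λ a → toℕ c <ᵇ toℕ a) w → (M : Maybe ℕ) →
  suc (reach (lookup y c) 0 (occupancyBits y c w)) ≡ formula (lookup y c) (wt y w) M →
  suc (reach (lookup y c) 0 (occupancyBits y c (β ++ α ++ w))) ≡
    formula (lookup y c) (wt y (β ++ α ++ w))
      (if lookup y c ≤ᵇ wt y α then just (wt y β) else Maybe.map (λ r → wt y β + wt y α + r) M)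
reach-block y ypos c β α w β<c c<α ex head M ih = begin
  suc (reach L 0 (occupancyBits y c (β ++ α ++ w)))
    ≡⟨ cong (λ z → suc (reach L 0 z)) bits ⟩
  suc (reach L 0 (replicate (wt y β) true ++ (replicate (wt y α) false ++ B)))
    ≡⟨ cong suc (reach-trues L (wt y β) _ (ypos c)) ⟩
  suc (wt y β + reach L 0 (replicate (wt y α) false ++ B))
    ≡⟨ reach-block-bits L (wt y β) (wt y α) B (wt y w) M (ypos c) (reach-startIndependent y ypos c w ex head) ih ⟩
  formula L (wt y β + (wt y α + wt y w)) next
    ≡⟨ cong (λ W → formula L W next) (sym (trans (wt-++ y β (α ++ w)) (cong (wt y β +_) (wt-++ y α w)))) ⟩
  formula L (wt y (β ++ α ++ w)) next ∎
  where
  open ≡-Reasoning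
  L : ℕ
  L = lookup y c
  B : List Bool
  B = occupancyBits y c w
  next : Maybe ℕ
  next = if L ≤ᵇ wt y α then just (wt y β) else Maybe.map (λ r → wt y β + wt y α + r) M
  bits : occupancyBits y c (β ++ α ++ w) ≡ replicate (wt y β) true ++ (replicate (wt y α) false ++ B)
  bits = trans (occupancyBits-++ y c β (α ++ w))
    (cong₂ _++_ (occupancyBits-earlier y c β β<c)
                (trans (occupancyBits-++ y c α w) (cong (_++ B) (occupancyBits-later y c α c<α))))

headNeitherEarlierNorLater⇒[] : ∀ {n} (c : Fin n) w → Excludes c w →
  HeadFails (λ a → toℕ a <ᵇ toℕ c) w → HeadFails (λ a → toℕ c <ᵇ toℕ a) w → w ≡ []
headNeitherEarlierNorLater⇒[] c []      _         _   _   = refl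
headNeitherEarlierNorLater⇒[] c (a ∷ w) (a≢c ∷ _) a≮c c≮a = ⊥-elim (a≢c (≮ᵇ∧≯ᵇ⇒≡ (toℕ a) (toℕ c) a≮c c≮a))

reach≡blocksAux : ∀ {n} (y : Vec ℕ n) → (∀ i → 1 ≤ lookup y i) → ∀ (c : Fin n) fuel w → length w ≤ fuel →
  Excludes c w → HeadFails (λ a → toℕ c <ᵇ toℕ a) w →
  suc (reach (lookup y c) 0 (occupancyBits y c w)) ≡ formula (lookup y c) (wt y w) (mSum y (lookup y c) (blocksAux fuel c w))
reach≡blocksAux y ypos c zero [] _ _ _ = refl
reach≡blocksAux y ypos c (suc fuel) w |w|≤ ex head
  with spanᵇ (λ a → toℕ a <ᵇ toℕ c) w | spanᵇ-spec (λ a → toℕ a <ᵇ toℕ c) w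
... | (β , w′) | (w≡ , β<c , head′) with spanᵇ (λ a → toℕ c <ᵇ toℕ a) w′ | spanᵇ-spec (λ a → toℕ c <ᵇ toℕ a) w′
...   | ([] , w″) | (w′≡ , _ , head″) = cong suc (reach-allEarlier y c w (ypos c) w<c)
  where
  w′≡[] : w′ ≡ []
  w′≡[] = headNeitherEarlierNorLater⇒[] c w′ (Excludes-suffix c β (subst (Excludes c) w≡ ex)) head′
            (subst (HeadFails (λ a → toℕ c <ᵇ toℕ a)) (sym w′≡) head″)
  w<c : Allᵇ (λ a → toℕ a <ᵇ toℕ c) w
  w<c = subst (Allᵇ (λ a → toℕ a <ᵇ toℕ c)) (sym (trans w≡ (trans (cong (β ++_) w′≡[]) (++-identityʳ β)))) β<c
...   | (a ∷ α , w″) | (w′≡ , c<α , head″) =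
  subst (λ v → suc (reach (lookup y c) 0 (occupancyBits y c v)) ≡ formula (lookup y c) (wt y v) next) (sym w≡βαw″)
    (reach-block y ypos c β (a ∷ α) w″ β<c c<α ex″ head″ M (reach≡blocksAux y ypos c fuel w″ |w″|≤ ex″ head″))
  where
  M : Maybe ℕ
  M = mSum y (lookup y c) (blocksAux fuel c w″)
  next : Maybe ℕ
  next = if lookup y c ≤ᵇ wt y (a ∷ α) then just (wt y β) else Maybe.map (λ r → wt y β + wt y (a ∷ α) + r) M
  w≡βαw″ : w ≡ β ++ (a ∷ α) ++ w″
  w≡βαw″ = trans w≡ (cong (β ++_) w′≡)
  ex″ : Excludes c w″
  ex″ = Excludes-suffix c (a ∷ α) (Excludes-suffix c β (subst (Excludes c) w≡βαw″ ex))
  |w″|≤ : length w″ ≤ fuel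
  |w″|≤ = ≤-pred (≤-trans (≤-trans (s≤s (m≤n+m (length w″) (length α))) (m≤n+m _ (length β)))
                          (≤-trans (≤-reflexive (sym |w|)) |w|≤))
    where
    |w| : length w ≡ length β + suc (length α + length w″)
    |w| = trans (cong length w≡βαw″) (trans (length-++ β) (cong (λ k → length β + suc k) (length-++ α)))

P-body : ∀ {n} → Vec ℕ n → Fin n → List (Fin n) → ℕ
P-body y c []         = 1
P-body y c (p ∷ rest) =
  if toℕ c <ᵇ toℕ p then 1
  else if all (λ a → toℕ a <ᵇ toℕ c) (p ∷ rest)
       then 1 + wt y (p ∷ rest)
       else formula (lookup y c) (wt y (p ∷ rest)) (mSum y (lookup y c) (blocks c (p ∷ rest)))

Pσ≡P-body : ∀ {n} (y : Vec ℕ n) (σ : Vec (Fin n) n) i →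
  Pσ y σ i ≡ P-body y (lookup σ i) (reverse (take (toℕ i) (toList σ)))
Pσ≡P-body y σ i with reverse (take (toℕ i) (toList σ))
... | [] = refl
... | p ∷ rest with toℕ (lookup σ i) <ᵇ toℕ p
...   | true = refl
...   | false with all (λ a → toℕ a <ᵇ toℕ (lookup σ i)) (p ∷ rest)
...     | true = refl
...     | false with mSum y (lookup y (lookup σ i)) (blocks (lookup σ i) (p ∷ rest))
...       | nothing = refl
...       | just s  = refl

reach≡P-body : ∀ {n} (y : Vec ℕ n) → (∀ i → 1 ≤ lookup y i) → ∀ c w → Excludes c w →
  suc (reach (lookup y c) (lookup y c) (occupancyBits y c w)) ≡ P-body y c w
reach≡P-body y ypos c []         _  = refl
reach≡P-body y ypos c (p ∷ rest) ex with toℕ c <ᵇ toℕ p in c<p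
... | true rewrite <ᵇ-asym (toℕ c) (toℕ p) c<p = blocked (lookup y p) (ypos p)
  where
  blocked : ∀ k → 1 ≤ k → suc (reach (lookup y c) (lookup y c) (replicate k false ++ occupancyBits y c rest)) ≡ 1
  blocked (suc k) _ rewrite T⇒≡true (≤⇒≤ᵇ (n≤1+n (lookup y c))) = refl
... | false = trans (cong suc (reach-startIndependent y ypos c (p ∷ rest) ex c<p (lookup y c) 0)) fromZero
  where
  fromZero : suc (reach (lookup y c) 0 (occupancyBits y c (p ∷ rest))) ≡
    (if all (λ a → toℕ a <ᵇ toℕ c) (p ∷ rest) then 1 + wt y (p ∷ rest)
     else formula (lookup y c) (wt y (p ∷ rest)) (mSum y (lookup y c) (blocks c (p ∷ rest))))
  fromZero with all (λ a → toℕ a <ᵇ toℕ c) (p ∷ rest) in all<c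
  ... | true  = cong suc (reach-allEarlier y c (p ∷ rest) (ypos c) (all⇒All _ (p ∷ rest) all<c))
  ... | false = reach≡blocksAux y ypos c (length (p ∷ rest)) (p ∷ rest) ≤-refl ex c<p

module Layout {n : ℕ} (y : Vec ℕ n) where

  Y : Fin n → ℕ
  Y = lookup y

  Contiguous : (Fin n → ℕ) → ℕ → List (Fin n) → Set
  Contiguous F lo []       = ⊤
  Contiguous F lo (a ∷ zs) = F a ≡ lo × Contiguous F (lo + Y a) zs

  Contiguous-cong : ∀ {F G} lo zs → (∀ c → c ∈ zs → F c ≡ G c) → Contiguous F lo zs → Contiguous G lo zs
  Contiguous-cong lo []       _ _          = tt
  Contiguous-cong lo (a ∷ zs) h (Fa , lay) =
    trans (sym (h a (here refl))) Fa , Contiguous-cong (lo + Y a) zs (λ c m → h c (there m)) lay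

  Contiguous-++⁻ : ∀ {F} lo ps qs → Contiguous F lo (ps ++ qs) → Contiguous F lo ps × Contiguous F (lo + wt y ps) qs
  Contiguous-++⁻ {F} lo []       qs lay        = tt , subst (λ z → Contiguous F z qs) (sym (+-identityʳ lo)) lay
  Contiguous-++⁻ {F} lo (a ∷ ps) qs (Fa , lay) with Contiguous-++⁻ (lo + Y a) ps qs lay
  ... | layp , layq = (Fa , layp) , subst (λ z → Contiguous F z qs) (+-assoc lo (Y a) (wt y ps)) layq

  Contiguous⇒start≤ : ∀ {F} lo zs → Contiguous F lo zs → ∀ c → c ∈ zs → lo ≤ F c
  Contiguous⇒start≤ lo (a ∷ zs) (Fa , _)   c (here refl) = ≤-reflexive (sym Fa)
  Contiguous⇒start≤ lo (a ∷ zs) (_ , lay) c (there m)   = ≤-trans (m≤m+n lo (Y a)) (Contiguous⇒start≤ (lo + Y a) zs lay c m)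

  Contiguous⇒end≤ : ∀ {F} lo zs → Contiguous F lo zs → ∀ c → c ∈ zs → F c + Y c ≤ lo + wt y zs
  Contiguous⇒end≤ lo (a ∷ zs) (Fa , _) c (here refl) =
    ≤-trans (≤-reflexive (cong (_+ Y a) Fa)) (+-monoʳ-≤ lo (m≤m+n (Y a) (wt y zs)))
  Contiguous⇒end≤ lo (a ∷ zs) (_ , lay) c (there m) =
    ≤-trans (Contiguous⇒end≤ (lo + Y a) zs lay c m) (≤-reflexive (+-assoc lo (Y a) (wt y zs)))

  Contiguous⇒IncreasingBy : (∀ i → 1 ≤ Y i) → ∀ {F} lo zs → Contiguous F lo zs → IncreasingBy F zs
  Contiguous⇒IncreasingBy ypos lo []       _          = []
  Contiguous⇒IncreasingBy ypos lo (a ∷ zs) (Fa , lay) =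
    All.tabulate (λ {z} z∈ → <-≤-trans (subst (_< lo + Y a) (sym Fa) (m<m+n lo (ypos a))) (Contiguous⇒start≤ (lo + Y a) zs lay z z∈))
    ∷ Contiguous⇒IncreasingBy ypos (lo + Y a) zs lay

  Contiguous-unique : ∀ {F G} lo zs → Contiguous F lo zs → Contiguous G lo zs → ∀ c → c ∈ zs → F c ≡ G c
  Contiguous-unique lo (a ∷ zs) (Fa , _)   (Ga , _)    c (here refl) = trans Fa (sym Ga)
  Contiguous-unique lo (a ∷ zs) (_ , layF) (_ , layG) c (there m)   = Contiguous-unique (lo + Y a) zs layF layG c m

  Sorted-within : (Fin n → ℕ) → ℕ → List (Fin n) → ℕ → Set
  Sorted-within s lo []       hi = lo ≤ hi
  Sorted-within s lo (a ∷ zs) hi = lo ≤ s a × Sorted-within s (s a + Y a) zs hi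

  Sorted-within⇒wt≤ : ∀ s lo zs hi → Sorted-within s lo zs hi → lo + wt y zs ≤ hi
  Sorted-within⇒wt≤ s lo []       hi lo≤hi         = ≤-trans (≤-reflexive (+-identityʳ lo)) lo≤hi
  Sorted-within⇒wt≤ s lo (a ∷ zs) hi (lo≤sa , rest) =
    ≤-trans (≤-reflexive (sym (+-assoc lo (Y a) (wt y zs))))
      (≤-trans (+-monoˡ-≤ (wt y zs) (+-monoˡ-≤ (Y a) lo≤sa)) (Sorted-within⇒wt≤ s (s a + Y a) zs hi rest))

  Sorted-within-full⇒Contiguous : ∀ s lo zs hi → Sorted-within s lo zs hi → lo + wt y zs ≡ hi → Contiguous s lo zs
  Sorted-within-full⇒Contiguous s lo []       hi _              _    = tt
  Sorted-within-full⇒Contiguous s lo (a ∷ zs) hi (lo≤sa , rest) full =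
    sa≡lo , subst (λ z → Contiguous s (z + Y a) zs) sa≡lo (Sorted-within-full⇒Contiguous s (s a + Y a) zs hi rest full′)
    where
    bound : s a + Y a + wt y zs ≤ lo + Y a + wt y zs
    bound = ≤-trans (Sorted-within⇒wt≤ s (s a + Y a) zs hi rest)
                    (≤-reflexive (trans (sym full) (sym (+-assoc lo (Y a) (wt y zs)))))
    sa≡lo : s a ≡ lo
    sa≡lo = ≤-antisym (+-cancelʳ-≤ (Y a) (s a) lo (+-cancelʳ-≤ (wt y zs) _ _ bound)) lo≤sa
    full′ : s a + Y a + wt y zs ≡ hi
    full′ = trans (cong (λ z → z + Y a + wt y zs) sa≡lo) (trans (+-assoc lo (Y a) (wt y zs)) full)

  ContiguousLeftward : (Fin n → ℕ) → ℕ → List (Fin n) → Set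
  ContiguousLeftward F lo []      = ⊤
  ContiguousLeftward F lo (a ∷ w) = F a ≡ lo + wt y w × ContiguousLeftward F lo w

  ContiguousLeftward-∷ʳ : ∀ F lo a w → F a ≡ lo → ContiguousLeftward F (lo + Y a) w → ContiguousLeftward F lo (w ++ [ a ])
  ContiguousLeftward-∷ʳ F lo a []      Fa _          = trans Fa (sym (+-identityʳ lo)) , tt
  ContiguousLeftward-∷ʳ F lo a (b ∷ w) Fa (Fb , lay) =
    trans Fb (trans (regroup lo (Y a) (wt y w)) (cong (lo +_) (sym (wt-++ y w [ a ])))) , ContiguousLeftward-∷ʳ F lo a w Fa lay
    where
    regroup : ∀ lo ya ww → lo + ya + ww ≡ lo + (ww + (ya + 0))
    regroup = solve-∀

  Contiguous⇒Leftward : ∀ F lo ps → Contiguous F lo ps → ContiguousLeftward F lo (reverse ps)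
  Contiguous⇒Leftward F lo []       _          = tt
  Contiguous⇒Leftward F lo (a ∷ ps) (Fa , lay) = subst (ContiguousLeftward F lo) (sym (unfold-reverse a ps))
    (ContiguousLeftward-∷ʳ F lo a (reverse ps) Fa (Contiguous⇒Leftward F (lo + Y a) ps lay))

  ContiguousLeftward⇒end≤ : ∀ F lo w → ContiguousLeftward F lo w → ∀ c → c ∈ w → F c + Y c ≤ lo + wt y w
  ContiguousLeftward⇒end≤ F lo (a ∷ w) (Fa , _) c (here refl) =
    ≤-reflexive (trans (cong (_+ Y a) Fa) (trans (+-assoc lo (wt y w) (Y a)) (cong (lo +_) (+-comm (wt y w) (Y a)))))
  ContiguousLeftward⇒end≤ F lo (a ∷ w) (_ , lay) c (there m) =
    ≤-trans (ContiguousLeftward⇒end≤ F lo w lay c m) (+-monoʳ-≤ lo (m≤n+m (wt y w) (Y a)))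

  occupiedByEarlier : (Fin n → ℕ) → Fin n → List (Fin n) → ℕ → Bool
  occupiedByEarlier F c w t = any (λ a → (toℕ a <ᵇ toℕ c) ∧ inBlock (F a) (Y a) t) w

  DescribesBelow-occupancyBits : ∀ F c w → ContiguousLeftward F 0 w →
    DescribesBelow (occupiedByEarlier F c w) (occupancyBits y c w) (wt y w)
  DescribesBelow-occupancyBits F c []      _          = refl
  DescribesBelow-occupancyBits F c (a ∷ w) (Fa , lay) =
    DescribesBelow-replicate (occupiedByEarlier F c (a ∷ w)) (Y a) (wt y w) _ (occupancyBits y c w) onA
      (DescribesBelow-cong (occupiedByEarlier F c w) (occupiedByEarlier F c (a ∷ w)) (occupancyBits y c w) (wt y w) below
        (DescribesBelow-occupancyBits F c w lay))
    where
    a<c : Bool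
    a<c = toℕ a <ᵇ toℕ c
    rest-free : ∀ t → wt y w ≤ t → occupiedByEarlier F c w t ≡ false
    rest-free t w≤t = any-none _ w (λ b b∈ → trans (cong ((toℕ b <ᵇ toℕ c) ∧_)
      (inBlock-false (F b) (Y b) t (λ _ t< → <-irrefl refl (<-≤-trans t< (≤-trans (ContiguousLeftward⇒end≤ F 0 w lay b b∈) w≤t)))))
      (∧-zeroʳ _))
    onA : ∀ t → wt y w ≤ t → t < Y a + wt y w → occupiedByEarlier F c (a ∷ w) t ≡ a<c
    onA t w≤t t<
      rewrite inBlock-intro (F a) (Y a) t (subst (_≤ t) (sym Fa) w≤t)
                (subst (t <_) (sym (trans (cong (_+ Y a) Fa) (+-comm (wt y w) (Y a)))) t<)
            | rest-free t w≤t = trans (∨-identityʳ _) (∧-identityʳ a<c)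
    below : ∀ t → t < wt y w → occupiedByEarlier F c w t ≡ occupiedByEarlier F c (a ∷ w) t
    below t t<w rewrite inBlock-false (F a) (Y a) t (λ Fa≤t _ → <-irrefl refl (<-≤-trans t<w (subst (_≤ t) Fa Fa≤t)))
                      | ∧-zeroʳ a<c = refl

  Sorted-within-increasing : ∀ (s : Fin n → ℕ) → (∀ a b → s a < s b → s a + Y a ≤ s b) → ∀ hi → (∀ j → s j + Y j ≤ hi) →
    ∀ lo zs → IncreasingBy s zs → lo ≤ hi → (∀ z → z ∈ zs → lo ≤ s z) → Sorted-within s lo zs hi
  Sorted-within-increasing s apart hi within lo []       _           lo≤hi _     = lo≤hi
  Sorted-within-increasing s apart hi within lo (a ∷ zs) (a< ∷ inc) lo≤hi lo≤zs =
    lo≤zs a (here refl) ,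
    Sorted-within-increasing s apart hi within (s a + Y a) zs inc (within a) (λ z z∈ → apart a z (All.lookup a< z∈))

module Parked {n : ℕ} (y : Vec ℕ n) (ypos : ∀ i → 1 ≤ lookup y i) (x : Vec (Fin (street y)) n) (s : Vec ℕ n)
              (park≡ : park y x ≡ just s) where

  open Placement (parkFrom-placement (street y) [] (Vec.map toℕ x) y s park≡) public using (within; disjoint)

  inOwnBlock : ∀ a → inBlock (lookup s a) (lookup y a) (lookup s a) ≡ true
  inOwnBlock a = inBlock-intro (lookup s a) (lookup y a) (lookup s a) ≤-refl (m<m+n _ (ypos a))

  start-injective : ∀ a b → lookup s a ≡ lookup s b → a ≡ b
  start-injective a b sa≡sb with a ≟ᶠ b
  ... | yes a≡b = a≡b
  ... | no  a≢b with () ← trans (sym (subst (λ z → inBlock (lookup s b) (lookup y b) z ≡ true) (sym sa≡sb) (inOwnBlock b)))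
                                (disjoint a b a≢b (lookup s a) (inOwnBlock a))

  apart : ∀ a b → lookup s a < lookup s b → lookup s a + lookup y a ≤ lookup s b
  apart a b sa<sb with lookup s a + lookup y a ≤? lookup s b
  ... | yes ok = ok
  ... | no  ¬apart with () ← trans (sym (inOwnBlock b))
          (disjoint a b (λ { refl → <-irrefl refl sa<sb }) (lookup s b) (inBlock-intro (lookup s a) (lookup y a) (lookup s b) (<⇒≤ sa<sb) (≰⇒> ¬apart)))

-- The fibre of an outcome

before : ∀ {n} → Fin n → List (Fin n) → List (Fin n)
before c []       = []
before c (a ∷ as) with a ≟ᶠ c
... | yes _ = []
... | no  _ = a ∷ before c as

module Fibre {n : ℕ} (y : Vec ℕ n) (ypos : ∀ i → 1 ≤ lookup y i) (σ : Vec (Fin n) n)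
             (σ-distinct : distinct (toList σ) ≡ true) where

  open Layout y

  m : ℕ
  m = street y
  xs : List (Fin n)
  xs = toList σ

  xs-unique : Unique xs
  xs-unique = distinct⇒Unique xs σ-distinct

  xs-complete : ∀ k → k ∈ xs
  xs-complete = Unique-complete xs xs-unique (Vec.length-toList σ)

  xs↭allFin : xs ↭ allFin n
  xs↭allFin = Unique-complete⇒↭allFin xs xs-unique xs-complete

  wt-xs : wt y xs ≡ m
  wt-xs = trans (sum-↭ (map⁺ (lookup y) xs↭allFin))
                (trans (cong sum (sym (toList≡map-lookup y))) (toList-sum y))
    where
    toList-sum : ∀ {k} (v : Vec ℕ k) → sum (toList v) ≡ Vec.sum v
    toList-sum []      = refl
    toList-sum (a ∷ v) = cong (a +_) (toList-sum v)

  Contiguous-before : ∀ zs lo → Unique zs → Contiguous (λ c → lo + wt y (before c zs)) lo zs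
  Contiguous-before []       lo _          = tt
  Contiguous-before (a ∷ zs) lo (a≢ ∷ u) = first , Contiguous-cong (lo + Y a) zs shift (Contiguous-before zs (lo + Y a) u)
    where
    first : lo + wt y (before a (a ∷ zs)) ≡ lo
    first with a ≟ᶠ a
    ... | yes _  = +-identityʳ lo
    ... | no a≢a = ⊥-elim (a≢a refl)
    shift : ∀ c → c ∈ zs → lo + Y a + wt y (before c zs) ≡ lo + wt y (before c (a ∷ zs))
    shift c c∈ with a ≟ᶠ c
    ... | yes refl = ⊥-elim (All.lookup a≢ c∈ refl)
    ... | no  _    = +-assoc lo (Y a) _

  start : Fin n → ℕ
  start c = wt y (before c xs)

  starts : Vec ℕ n
  starts = Vec.tabulate start

  start-contiguous : Contiguous start 0 xs
  start-contiguous = Contiguous-before xs 0 xs-unique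

  starts-outcome : strictlyIncreasing (map (lookup starts) xs) ≡ true
  starts-outcome = trans (cong strictlyIncreasing (map-cong (Vec.lookup∘tabulate start) xs))
    (IncreasingBy⇒strictlyIncreasing start xs (Contiguous⇒IncreasingBy ypos 0 xs start-contiguous))

  -- The street is exactly full, so the outcome σ forces the cars to be packed in the order σ.
  outcome⇒starts : ∀ (x : Vec (Fin m) n) s → park y x ≡ just s → strictlyIncreasing (map (lookup s) xs) ≡ true → s ≡ starts
  outcome⇒starts x s park≡ increasing =
    Vec-ext s starts (λ c → trans (Contiguous-unique 0 xs contiguous start-contiguous c (xs-complete c))
                                  (sym (Vec.lookup∘tabulate start c)))
    where
    open Parked y ypos x s park≡
    contiguous : Contiguous (lookup s) 0 xs
    contiguous = Sorted-within-full⇒Contiguous (lookup s) 0 xs m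
      (Sorted-within-increasing (lookup s) apart m within 0 xs (strictlyIncreasing⇒IncreasingBy (lookup s) xs increasing)
        z≤n (λ _ _ → z≤n))
      wt-xs

  conditions : Vec (ℕ → Bool) n
  conditions = landsAt m [] starts y

  hasOutcome≡pointwise : ∀ (x : Vec (Fin m) n) → hasOutcome y σ x ≡ pointwiseᵇ conditions (Vec.map toℕ x)
  hasOutcome≡pointwise x with park y x in park≡
  ... | nothing = ≡true-ext (λ ()) (λ e → case (trans (sym park≡) (landsAt-sound m [] starts y (Vec.map toℕ x) e)))
    where
    case : nothing ≡ just starts → false ≡ true
    case ()
  ... | just s = ≡true-ext
    (λ e → landsAt-complete m [] starts y (Vec.map toℕ x) (subst (λ z → park y x ≡ just z) (outcome⇒starts x s park≡ e) park≡))
    (λ e → subst (λ z → strictlyIncreasing (map (lookup z) xs) ≡ true)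
                 (just-injective (trans (sym (landsAt-sound m [] starts y (Vec.map toℕ x) e)) park≡)) starts-outcome)

  module Car (i : Fin n) where

    c : Fin n
    c = lookup σ i
    pre : List (Fin n)
    pre = take (toℕ i) xs
    post : List (Fin n)
    post = drop (suc (toℕ i)) xs
    L : ℕ
    L = Y c

    xs≡ : xs ≡ pre ++ c ∷ post
    xs≡ = toList-split σ i
      where
      toList-split : ∀ {A : Set} {k} (v : Vec A k) (i : Fin k) →
        toList v ≡ take (toℕ i) (toList v) ++ lookup v i ∷ drop (suc (toℕ i)) (toList v)
      toList-split (a ∷ v) fzero    = refl
      toList-split (a ∷ v) (fsuc i) = cong (a ∷_) (toList-split v i)

    split : Contiguous start 0 pre × Contiguous start (0 + wt y pre) (c ∷ post)
    split = Contiguous-++⁻ 0 pre (c ∷ post) (subst (Contiguous start 0) xs≡ start-contiguous)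

    pre-contiguous : Contiguous start 0 pre
    pre-contiguous = proj₁ split

    start-c : start c ≡ wt y pre
    start-c = proj₁ (proj₂ split)

    post-contiguous : Contiguous start (wt y pre + L) post
    post-contiguous = proj₂ (proj₂ split)

    O : ℕ → Bool
    O = occupiedBefore c starts y

    earlierAt : ℕ → Fin n → Bool
    earlierAt t a = (toℕ a <ᵇ toℕ c) ∧ inBlock (start a) (Y a) t

    O≡any-pre : ∀ t → t < start c + L → O t ≡ any (earlierAt t) pre
    O≡any-pre t t< = begin
      O t                                                ≡⟨ occupiedBefore≡any c starts y t ⟩
      any (λ a → (toℕ a <ᵇ toℕ c) ∧ inBlock (lookup starts a) (Y a) t) (allFin n)
        ≡⟨ any-cong (allFin n) (λ a _ → cong (λ z → (toℕ a <ᵇ toℕ c) ∧ inBlock z (Y a) t) (Vec.lookup∘tabulate start a)) ⟩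
      any (earlierAt t) (allFin n)                       ≡⟨ any-↭ (earlierAt t) (↭-sym xs↭allFin) ⟩
      any (earlierAt t) xs                               ≡⟨ cong (any (earlierAt t)) xs≡ ⟩
      any (earlierAt t) (pre ++ c ∷ post)                ≡⟨ any-++ (earlierAt t) pre (c ∷ post) ⟩
      any (earlierAt t) pre ∨ any (earlierAt t) (c ∷ post) ≡⟨ cong (any (earlierAt t) pre ∨_) none-from-c ⟩
      any (earlierAt t) pre ∨ false                      ≡⟨ ∨-identityʳ _ ⟩
      any (earlierAt t) pre                              ∎
      where
      open ≡-Reasoning
      none-from-c : any (earlierAt t) (c ∷ post) ≡ false
      none-from-c rewrite <ᵇ-irrefl (toℕ c) = any-none (earlierAt t) post (λ a a∈ → trans
        (cong ((toℕ a <ᵇ toℕ c) ∧_) (inBlock-false (start a) (Y a) t (λ a≤t _ → <-irrefl refl (<-≤-trans t<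
          (≤-trans (≤-reflexive (cong (_+ L) start-c)) (≤-trans (Contiguous⇒start≤ (wt y pre + L) post post-contiguous a a∈) a≤t))))))
        (∧-zeroʳ _))

    free : ∀ t → start c ≤ t → t < start c + L → O t ≡ false
    free t c≤t t< = trans (O≡any-pre t t<) (any-none (earlierAt t) pre (λ a a∈ → trans
      (cong ((toℕ a <ᵇ toℕ c) ∧_) (inBlock-false (start a) (Y a) t (λ _ t<a → <-irrefl refl (<-≤-trans t<a
        (≤-trans (Contiguous⇒end≤ 0 pre pre-contiguous a a∈) (≤-trans (≤-reflexive (sym start-c)) c≤t))))))
      (∧-zeroʳ _)))

    fits : start c + L ≤ m
    fits = ≤-trans (Contiguous⇒end≤ 0 xs start-contiguous c (xs-complete c)) (≤-reflexive wt-xs)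

    w : List (Fin n)
    w = reverse pre

    describes : DescribesBelow O (occupancyBits y c w) (start c)
    describes = DescribesBelow-cong (occupiedByEarlier start c w) O (occupancyBits y c w) (start c) agree
      (subst (DescribesBelow (occupiedByEarlier start c w) (occupancyBits y c w)) wt-w
        (DescribesBelow-occupancyBits start c w (Contiguous⇒Leftward start 0 pre pre-contiguous)))
      where
      agree : ∀ t → t < start c → occupiedByEarlier start c w t ≡ O t
      agree t t< = trans (any-↭ (earlierAt t) (↭-reverse pre)) (sym (O≡any-pre t (<-≤-trans t< (m≤m+n (start c) L))))
      wt-w : wt y w ≡ start c
      wt-w = trans (sum-↭ (map⁺ (lookup y) (↭-reverse pre))) (sym start-c)

    excludes : Excludes c w
    excludes = All.tabulate (λ {a} a∈ a≡c →
      ∉-prefix pre (subst Unique xs≡ xs-unique) (subst (_∈ pre) (toℕ-injective a≡c) (∈-resp-↭ (↭-reverse pre) a∈)))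

    countBelow≡Pσ : countBelow (lookup conditions c) m ≡ Pσ y σ i
    countBelow≡Pσ = begin
      countBelow (lookup conditions c) m
        ≡⟨ countᵇ-cong (λ a → trans (lookup-landsAt m [] starts y c (toℕ a))
                                    (cong (λ z → eqJust (firstFitᵒ m O L (toℕ a) (suc m)) z) (Vec.lookup∘tabulate start c)))
                       (allFin m) ⟩
      countBelow (Landing.lands m O L (start c) (ypos c) fits free) m
        ≡⟨ Landing.countBelow-lands m O L (start c) (ypos c) fits free (occupancyBits y c w) describes ⟩
      suc (reach L L (occupancyBits y c w))
        ≡⟨ reach≡P-body y ypos c w excludes ⟩
      P-body y c w
        ≡⟨ Pσ≡P-body y σ i ⟨
      Pσ y σ i ∎
      where open ≡-Reasoning

  fibre-size : length (outcomeFibre y σ) ≡ prodP y σ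
  fibre-size = begin
    countᵇ (hasOutcome y σ) (allVecs m n)
      ≡⟨ countᵇ-cong hasOutcome≡pointwise (allVecs m n) ⟩
    countᵇ (pointwiseᵇ conditions ∘ Vec.map toℕ) (allVecs m n)
      ≡⟨ countᵇ-allVecs-pointwise m conditions ⟩
    product (toList (Vec.map (λ f → countBelow f m) conditions))
      ≡⟨ cong product (trans (toList≡map-lookup (Vec.map (λ f → countBelow f m) conditions))
                             (map-cong (λ j → Vec.lookup-map j (λ f → countBelow f m) conditions) (allFin n))) ⟩
    product (map (λ c → countBelow (lookup conditions c) m) (allFin n))
      ≡⟨ product-↭ (map⁺ (λ c → countBelow (lookup conditions c) m) (↭-sym xs↭allFin)) ⟩
    product (map (λ c → countBelow (lookup conditions c) m) xs)
      ≡⟨ cong (λ z → product (map (λ c → countBelow (lookup conditions c) m) z)) (toList≡map-lookup σ) ⟩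
    product (map (λ c → countBelow (lookup conditions c) m) (map (lookup σ) (allFin n)))
      ≡⟨ cong product (map-∘ (allFin n)) ⟨
    product (map (λ i → countBelow (lookup conditions (lookup σ i)) m) (allFin n))
      ≡⟨ cong product (map-cong (Car.countBelow≡Pσ) (allFin n)) ⟩
    product (map (Pσ y σ) (allFin n)) ∎
    where open ≡-Reasoning

-- Every parking assortment has exactly one outcome

equalTo : ∀ {K k} → Vec (Fin K) k → Vec (ℕ → Bool) k
equalTo = Vec.map (λ a t → t ≡ᵇ toℕ a)

pointwise-equalTo-self : ∀ {K k} (u : Vec (Fin K) k) → pointwiseᵇ (equalTo u) (Vec.map toℕ u) ≡ true
pointwise-equalTo-self []      = refl
pointwise-equalTo-self (a ∷ u) rewrite ≡ᵇ-refl (toℕ a) = pointwise-equalTo-self u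

pointwise-equalTo⇒≡ : ∀ {K k} (u v : Vec (Fin K) k) → pointwiseᵇ (equalTo u) (Vec.map toℕ v) ≡ true → v ≡ u
pointwise-equalTo⇒≡ []      []      _ = refl
pointwise-equalTo⇒≡ (a ∷ u) (b ∷ v) e with ∧≡true⇒ {toℕ b ≡ᵇ toℕ a} e
... | b≡a , v≡u = cong₂ _∷_ (toℕ-injective (≡ᵇ⇒≡ (toℕ b) (toℕ a) (≡true⇒T b≡a))) (pointwise-equalTo⇒≡ u v v≡u)

product-countBelow-equalTo : ∀ {K k} (u : Vec (Fin K) k) → product (toList (Vec.map (λ f → countBelow f K) (equalTo u))) ≡ 1
product-countBelow-equalTo []          = refl
product-countBelow-equalTo {K} (a ∷ u) = cong₂ _*_ (countBelow-≡ᵇ K a) (product-countBelow-equalTo u)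

countᵇ-allVecs-singleton : ∀ {K k} (Q : Vec (Fin K) k → Bool) (u : Vec (Fin K) k) → Q u ≡ true →
  (∀ v → Q v ≡ true → v ≡ u) → countᵇ Q (allVecs K k) ≡ 1
countᵇ-allVecs-singleton {K} {k} Q u Qu only-u = begin
  countᵇ Q (allVecs K k)                                          ≡⟨ countᵇ-cong Q≡ (allVecs K k) ⟩
  countᵇ (pointwiseᵇ (equalTo u) ∘ Vec.map toℕ) (allVecs K k)     ≡⟨ countᵇ-allVecs-pointwise K (equalTo u) ⟩
  product (toList (Vec.map (λ f → countBelow f K) (equalTo u)))   ≡⟨ product-countBelow-equalTo u ⟩
  1                                                               ∎
  where
  open ≡-Reasoning
  Q≡ : ∀ v → Q v ≡ pointwiseᵇ (equalTo u) (Vec.map toℕ v)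
  Q≡ v = ≡true-ext (λ Qv → subst (λ z → pointwiseᵇ (equalTo u) (Vec.map toℕ z) ≡ true) (sym (only-u v Qv)) (pointwise-equalTo-self u))
                   (λ e → subst (λ z → Q z ≡ true) (sym (pointwise-equalTo⇒≡ u v e)) Qu)

module UniqueOutcome {n : ℕ} (y : Vec ℕ n) (ypos : ∀ i → 1 ≤ lookup y i) (x : Vec (Fin (street y)) n) (s : Vec ℕ n)
                     (park≡ : park y x ≡ just s) where

  open Parked y ypos x s park≡
  open InsertionSort (lookup s) start-injective

  isOutcome : Vec (Fin n) n → Bool
  isOutcome σ = distinct (toList σ) ∧ strictlyIncreasing (map (lookup s) (toList σ))

  allFin-increasing : IncreasingBy (lookup s) (toList (sort (Vec.allFin n)))
  allFin-increasing = sort-increasing (Vec.allFin n) (subst Unique (sym (toList-tabulate (λ i → i))) (allFin⁺ n))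

  sorted-complete : ∀ k → k ∈ toList (sort (Vec.allFin n))
  sorted-complete k = ∈-resp-↭ (↭-sym (sort-↭ (Vec.allFin n))) (subst (k ∈_) (sym (toList-tabulate (λ i → i))) (∈-allFin k))

  isOutcome-sorted : isOutcome (sort (Vec.allFin n)) ≡ true
  isOutcome-sorted rewrite Unique⇒distinct _ (IncreasingBy⇒Unique (lookup s) allFin-increasing) =
    IncreasingBy⇒strictlyIncreasing (lookup s) _ allFin-increasing

  isOutcome⇒sorted : ∀ σ → isOutcome σ ≡ true → σ ≡ sort (Vec.allFin n)
  isOutcome⇒sorted σ e with ∧≡true⇒ {distinct (toList σ)} e
  ... | σ-distinct , increasing = toList-injective σ _
    (IncreasingBy-sameElements⇒≡ (lookup s) (toList σ) _ (strictlyIncreasing⇒IncreasingBy (lookup s) (toList σ) increasing)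
      allFin-increasing (λ {z} _ → sorted-complete z)
      (λ {z} _ → Unique-complete (toList σ) (distinct⇒Unique (toList σ) σ-distinct) (Vec.length-toList σ) z))

  count-outcomes : countᵇ isOutcome (allVecs n n) ≡ 1
  count-outcomes = countᵇ-allVecs-singleton isOutcome (sort (Vec.allFin n)) isOutcome-sorted isOutcome⇒sorted

count-outcomes : ∀ {n} (y : Vec ℕ n) → (∀ i → 1 ≤ lookup y i) → ∀ x →
  countᵇ (λ σ → hasOutcome y σ x) (perms n) ≡ indicator (isPA y x)
count-outcomes {n} y ypos x with park y x in park≡
... | nothing = countᵇ-none _ (perms n) (λ _ → refl)
... | just s  = trans (countᵇ-filterᵇ _ (λ σ → distinct (toList σ)) (allVecs n n)) (UniqueOutcome.count-outcomes y ypos x s park≡)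

corollary3p7 : (n : ℕ) (y : Vec ℕ n) → (∀ (i : Fin n) → 1 ≤ lookup y i) →
    (length (PA y) ≡ sum (map (λ σ → length (outcomeFibre y σ)) (perms n)))
    × (sum (map (λ σ → length (outcomeFibre y σ)) (perms n)) ≡ sum (map (prodP y) (perms n)))
corollary3p7 n y ypos = assortments-by-outcome , fibres-by-formula
  where
  X : List (Vec (Fin (street y)) n)
  X = allVecs (street y) n
  assortments-by-outcome : length (PA y) ≡ sum (map (λ σ → length (outcomeFibre y σ)) (perms n))
  assortments-by-outcome = begin
    countᵇ (isPA y) X                                             ≡⟨ countᵇ≡sum (isPA y) X ⟩
    sum (map (indicator ∘ isPA y) X)                              ≡⟨ sum-map-cong X (λ x _ → count-outcomes y ypos x) ⟨
    sum (map (λ x → countᵇ (λ σ → hasOutcome y σ x) (perms n)) X) ≡⟨ sum-countᵇ-swap (hasOutcome y) (perms n) X ⟨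
    sum (map (λ σ → countᵇ (hasOutcome y σ) X) (perms n))         ∎
    where open ≡-Reasoning
  fibres-by-formula : sum (map (λ σ → length (outcomeFibre y σ)) (perms n)) ≡ sum (map (prodP y) (perms n))
  fibres-by-formula = sum-map-cong (perms n)
    (λ σ σ∈ → Fibre.fibre-size y ypos σ (∈-filterᵇ⁻ (λ σ → distinct (toList σ)) (allVecs n n) σ∈))
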